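{- Let $\Phi(\vec{x},\vec{S})$ be an $\mathcal{RQSPA}_\mathbb{Z}$ formula with $\vec{x}=(x_1,\dots,x_k)$ and $\vec{S}=(S_1,\dots,S_l)$. Then an $\mathcal{RQSPA}_\mathbb{N}$ formula $\Phi'(\vec{x^\pm},\vec{S^\pm})$ with $\vec{x^\pm}=(x_1^+,x_1^-,\dots,x_k^+,x_k^-)$ and $\vec{S^\pm}=(S_1^+,S_1^-,\dots,S_l^+,S_l^-)$ can be constructed effectively such that $\mathcal{M}(\mathcal{L}(\Phi))=\mathcal{L}(\Phi')$. Moreover, if $\Phi$ is an $\mathcal{RQSPA}^-_\mathbb{Z}$ formula, then $\Phi'$ is an $\mathcal{RQSPA}^-_\mathbb{N}$ formula.
   Context: $\mathcal{RQSPA}$ formulas: $\Phi ::= T_s \asymp T_s \mid T_i \bowtie T_i + c \mid T_m \bowtie 0 \mid \Phi\wedge\Phi \mid \neg\Phi \mid \forall x.\,\Phi \mid \forall S.\,\Phi$, $T_s ::= \emptyset \mid S \mid \{T_i\} \mid T_s\cup T_s \mid T_s\cap T_s \mid T_s\setminus T_s$, $T_i ::= c \mid x \mid \min(T_s) \mid \max(T_s)$, $T_m ::= c \mid x \mid \max(T_s)\mid \min(T_s) \mid T_m+T_m \mid T_m - T_m$, with $c\in\mathbb{Z}$, $\bowtie\in\{=,\le,\ge\}$, $\asymp\in\{=,\subseteq,\supseteq,\subset,\supset\}$, and the restriction that all set variables occurring in atomic formulas $T_m\bowtie 0$ are free. $\min,\max$ of the empty set are undefined and atoms with undefined terms are false.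 $\mathcal{RQSPA}_\mathbb{Z}$ interprets integer variables over $\mathbb{Z}$ and set variables over finite subsets of $\mathbb{Z}$ ($\mathbb{S}_\mathbb{Z}$); $\mathcal{RQSPA}_\mathbb{N}$ interprets them over $\mathbb{N}$ and finite subsets of $\mathbb{N}$ ($\mathbb{S}_\mathbb{N}$). $\mathcal{RQSPA}^-$ denotes the fragment without atoms of the form $T_m\bowtie 0$. $\mathcal{L}(\Phi(\vec x,\vec S))$ is the set of tuples $(n_1,\dots,n_k,A_1,\dots,A_l)$ satisfying $\Phi$. The encoding $\mathcal{M}$: for $n\in\mathbb{Z}$, $\mathcal{M}(n)=(n^+,n^-)$ with $(n^+,n^-)=(n,0)$ if $n\ge 0$ and $(0,-n)$ if $n<0$; for $A\in\mathbb{S}_\mathbb{Z}$, $\mathcal{M}(A)=(A^+,A^-)$ with $A^+=A\cap\mathbb{N}$ and $A^-=\{ -n\mid n\in A\setminus A^+\}$; on tuples, $\mathcal{M}(n_1,\dots,n_k,A_1,\dots,A_l)=(n_1^+,n_1^-,\dots,n_k^+,n_k^-,A_1^+,A_1^-,\dots,A_l^+,A_l^-)$, and $\mathcal{M}$ is applied elementwise to sets of tuples. -}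

module Defs where

open import Data.Nat using (ℕ; zero; suc)
open import Data.Integer as ℤ using (ℤ; +_; -[1+_]; _+_; _-_; _≤_; _≥_; _⊓_; _⊔_)
open import Data.Integer.Properties using () renaming (_≟_ to _≟ℤ_)
open import Data.Fin using (Fin)
open import Data.Vec as V using (Vec; []; _∷_; lookup)
open import Data.List as L using (List; []; _∷_; _++_; filter; mapMaybe)
open import Data.List.Membership.Propositional using (_∈_)
open import Data.List.Membership.DecPropositional _≟ℤ_ using (_∈?_)
open import Data.Maybe using (Maybe; just; nothing)
open import Data.Product using (Σ; _×_; _,_)
open import Relation.Nullary using (¬_)
open import Relation.Binary.PropositionalEquality using (_≡_)

-- Formula k l m : k integer variables in scope (free or bound, de Bruijn,
-- index 0 = innermost), l FREE set variables (never bound), m set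
-- variables bound by ∀S quantifiers (de Bruijn, index 0 = innermost).
-- Top-level formulas have m = 0.  The restriction "all set variables
-- occurring in atoms T_m ⋈ 0 are free" is enforced by letting T_m terms
-- contain only set terms with no bound set variables (STerm k l 0).

data IRel : Set where
  eqR leR geR : IRel

data SRel : Set where
  eqS subS supS ssubS ssupS : SRel

data STerm (k l m : ℕ) : Set
data ITerm (k l m : ℕ) : Set

data STerm k l m where
  ∅     : STerm k l m
  fvar  : Fin l → STerm k l m
  bvar  : Fin m → STerm k l m
  sing  : ITerm k l m → STerm k l m
  _∪ₛ_  : STerm k l m → STerm k l m → STerm k l m
  _∩ₛ_  : STerm k l m → STerm k l m → STerm k l m
  _∖ₛ_  : STerm k l m → STerm k l m → STerm k l m

data ITerm k l m where
  icst : ℤ → ITerm k l m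
  ivar : Fin k → ITerm k l m
  imin : STerm k l m → ITerm k l m
  imax : STerm k l m → ITerm k l m

data MTerm (k l : ℕ) : Set where
  mcst : ℤ → MTerm k l
  mvar : Fin k → MTerm k l
  mmax : STerm k l 0 → MTerm k l
  mmin : STerm k l 0 → MTerm k l
  _⊕_  : MTerm k l → MTerm k l → MTerm k l
  _⊖_  : MTerm k l → MTerm k l → MTerm k l

data Formula : ℕ → ℕ → ℕ → Set where
  sAtom : ∀ {k l m} → SRel → STerm k l m → STerm k l m → Formula k l m
  iAtom : ∀ {k l m} → IRel → ITerm k l m → ITerm k l m → ℤ → Formula k l m
  mAtom : ∀ {k l m} → IRel → MTerm k l → Formula k l m
  _∧ᶠ_  : ∀ {k l m} → Formula k l m → Formula k l m → Formula k l m
  ¬ᶠ_   : ∀ {k l m} → Formula k l m → Formula k l m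
  ∀ᵢ    : ∀ {k l m} → Formula (suc k) l m → Formula k l m
  ∀ₛ    : ∀ {k l m} → Formula k l (suc m) → Formula k l m

data Minus : ∀ {k l m} → Formula k l m → Set where
  sAtom : ∀ {k l m} r (s t : STerm k l m) → Minus (sAtom r s t)
  iAtom : ∀ {k l m} r (s t : ITerm k l m) c → Minus (iAtom r s t c)
  _∧ᶠ_  : ∀ {k l m} {φ ψ : Formula k l m} → Minus φ → Minus ψ → Minus (φ ∧ᶠ ψ)
  ¬ᶠ_   : ∀ {k l m} {φ : Formula k l m} → Minus φ → Minus (¬ᶠ φ)
  ∀ᵢ    : ∀ {k l m} {φ : Formula (suc k) l m} → Minus φ → Minus (∀ᵢ φ)
  ∀ₛ    : ∀ {k l m} {φ : Formula k l (suc m)} → Minus φ → Minus (∀ₛ φ)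

-- Finite sets are represented by lists (membership only
-- matters; all relations below are extensional).  Terms evaluate to
-- Maybe values; min/max of the empty set are undefined (nothing), and an
-- atom holds only if all its terms are defined.

minL : List ℤ → Maybe ℤ
minL [] = nothing
minL (x ∷ xs) with minL xs
... | nothing = just x
... | just y  = just (x ⊓ y)

maxL : List ℤ → Maybe ℤ
maxL [] = nothing
maxL (x ∷ xs) with maxL xs
... | nothing = just x
... | just y  = just (x ⊔ y)

map₂ : {A B C : Set} → (A → B → C) → Maybe A → Maybe B → Maybe C
map₂ f (just a) (just b) = just (f a b)
map₂ f _ _ = nothing

bindM : {A B : Set} → Maybe A → (A → Maybe B) → Maybe B
bindM nothing f = nothing
bindM (just a) f = f a

mapM : {A B : Set} → (A → B) → Maybe A → Maybe B
mapM f nothing = nothing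
mapM f (just a) = just (f a)

_∩L_ : List ℤ → List ℤ → List ℤ
A ∩L B = filter (_∈? B) A

_∖L_ : List ℤ → List ℤ → List ℤ
A ∖L B = filter (λ z → Relation.Nullary.¬? (z ∈? B)) A
  where import Relation.Nullary

evalS : ∀ {k l m} → STerm k l m → Vec ℤ k → Vec (List ℤ) l → Vec (List ℤ) m → Maybe (List ℤ)
evalI : ∀ {k l m} → ITerm k l m → Vec ℤ k → Vec (List ℤ) l → Vec (List ℤ) m → Maybe ℤ

evalS ∅ xs Fs Bs = just []
evalS (fvar i) xs Fs Bs = just (lookup Fs i)
evalS (bvar i) xs Fs Bs = just (lookup Bs i)
evalS (sing t) xs Fs Bs = mapM (λ z → z ∷ []) (evalI t xs Fs Bs)
evalS (s ∪ₛ t) xs Fs Bs = map₂ _++_ (evalS s xs Fs Bs) (evalS t xs Fs Bs)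
evalS (s ∩ₛ t) xs Fs Bs = map₂ _∩L_ (evalS s xs Fs Bs) (evalS t xs Fs Bs)
evalS (s ∖ₛ t) xs Fs Bs = map₂ _∖L_ (evalS s xs Fs Bs) (evalS t xs Fs Bs)

evalI (icst c) xs Fs Bs = just c
evalI (ivar i) xs Fs Bs = just (lookup xs i)
evalI (imin s) xs Fs Bs = bindM (evalS s xs Fs Bs) minL
evalI (imax s) xs Fs Bs = bindM (evalS s xs Fs Bs) maxL

evalM : ∀ {k l} → MTerm k l → Vec ℤ k → Vec (List ℤ) l → Maybe ℤ
evalM (mcst c) xs Fs = just c
evalM (mvar i) xs Fs = just (lookup xs i)
evalM (mmax s) xs Fs = bindM (evalS s xs Fs []) maxL
evalM (mmin s) xs Fs = bindM (evalS s xs Fs []) minL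
evalM (s ⊕ t) xs Fs = map₂ _+_ (evalM s xs Fs) (evalM t xs Fs)
evalM (s ⊖ t) xs Fs = map₂ _-_ (evalM s xs Fs) (evalM t xs Fs)

_⊆L_ : List ℤ → List ℤ → Set
A ⊆L B = ∀ z → z ∈ A → z ∈ B

holdsI : IRel → ℤ → ℤ → Set
holdsI eqR a b = a ≡ b
holdsI leR a b = a ≤ b
holdsI geR a b = a ≥ b

holdsS : SRel → List ℤ → List ℤ → Set
holdsS eqS   A B = A ⊆L B × B ⊆L A
holdsS subS  A B = A ⊆L B
holdsS supS  A B = B ⊆L A
holdsS ssubS A B = A ⊆L B × ¬ (B ⊆L A)
holdsS ssupS A B = B ⊆L A × ¬ (A ⊆L B)

-- Semantics parameterised by the domain D of integer variables and its
-- embedding ι into ℤ (D = ℤ for RQSPA_ℤ, D = ℕ for RQSPA_ℕ).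
-- Term values (constants c ∈ ℤ, arithmetic) live in ℤ.
module Sem (D : Set) (ι : D → ℤ) where

  ⟦_⟧ : ∀ {k l m} → Formula k l m → Vec ℤ k → Vec (List ℤ) l → Vec (List ℤ) m → Set
  ⟦ sAtom r s t ⟧ xs Fs Bs =
    Σ (List ℤ) λ A → Σ (List ℤ) λ B →
      evalS s xs Fs Bs ≡ just A × evalS t xs Fs Bs ≡ just B × holdsS r A B
  ⟦ iAtom r s t c ⟧ xs Fs Bs =
    Σ ℤ λ a → Σ ℤ λ b →
      evalI s xs Fs Bs ≡ just a × evalI t xs Fs Bs ≡ just b × holdsI r a (b + c)
  ⟦ mAtom r t ⟧ xs Fs Bs =
    Σ ℤ λ a → evalM t xs Fs ≡ just a × holdsI r a (+ 0)
  ⟦ φ ∧ᶠ ψ ⟧ xs Fs Bs = ⟦ φ ⟧ xs Fs Bs × ⟦ ψ ⟧ xs Fs Bs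
  ⟦ ¬ᶠ φ ⟧ xs Fs Bs = ¬ ⟦ φ ⟧ xs Fs Bs
  ⟦ ∀ᵢ φ ⟧ xs Fs Bs = (d : D) → ⟦ φ ⟧ (ι d ∷ xs) Fs Bs
  ⟦ ∀ₛ φ ⟧ xs Fs Bs = (A : List D) → ⟦ φ ⟧ xs Fs (L.map ι A ∷ Bs)

  ℒ : ∀ {k l} → Formula k l 0 → Vec D k → Vec (List D) l → Set
  ℒ Φ ns As = ⟦ Φ ⟧ (V.map ι ns) (V.map (L.map ι) As) []

ℒℤ : ∀ {k l} → Formula k l 0 → Vec ℤ k → Vec (List ℤ) l → Set
ℒℤ = Sem.ℒ ℤ (λ z → z)

ℒℕ : ∀ {k l} → Formula k l 0 → Vec ℕ k → Vec (List ℕ) l → Set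
ℒℕ = Sem.ℒ ℕ (λ n → + n)

double : ℕ → ℕ
double zero = zero
double (suc n) = suc (suc (double n))

encℤ⁺ encℤ⁻ : ℤ → ℕ
encℤ⁺ (+ n) = n
encℤ⁺ -[1+ n ] = 0
encℤ⁻ (+ n) = 0
encℤ⁻ -[1+ n ] = suc n

pos? neg? : ℤ → Maybe ℕ
pos? (+ n) = just n
pos? -[1+ n ] = nothing
neg? (+ n) = nothing
neg? -[1+ n ] = just (suc n)

encSet⁺ encSet⁻ : List ℤ → List ℕ
encSet⁺ = mapMaybe pos?
encSet⁻ = mapMaybe neg?

encInts : ∀ {k} → Vec ℤ k → Vec ℕ (double k)
encInts [] = []
encInts (n ∷ ns) = encℤ⁺ n ∷ encℤ⁻ n ∷ encInts ns

encSets : ∀ {l} → Vec (List ℤ) l → Vec (List ℕ) (double l)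
encSets [] = []
encSets (A ∷ As) = encSet⁺ A ∷ encSet⁻ A ∷ encSets As

_≋_ : ∀ {l} → Vec (List ℕ) l → Vec (List ℕ) l → Set
[] ≋ [] = Data.Unit.⊤
  where import Data.Unit
(A ∷ As) ≋ (B ∷ Bs) = ((z : ℕ) → (z ∈ A → z ∈ B) × (z ∈ B → z ∈ A)) × (As ≋ Bs)

-- An integer x is represented by naturals (x⁺, x⁻) with x = x⁺ - x⁻ and one of them 0, a finite set A
-- by its nonnegative part P and its negated negative part N. A set term is translated into finitely
-- many guarded cases (P, N): the Boolean operations act componentwise on the parts, and the extrema are
-- read off from the parts depending on which part is empty (min A = min P if N = ∅, else -max N).
-- Integer terms become pairs (p, n) likewise, and an atom holds iff some combination of cases holds
-- with the comparison rewritten on the parts; a mixed-sign comparison p₁ + n₂ ⋈ c becomes a finite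
-- disjunction over the values j ≤ c of p₁. Quantifiers range over the valid pairs (one component 0,
-- resp. 0 ∉ N). Disjunction is ¬(¬ ∧ ¬), so cases can be extracted only under a double negation; this
-- is harmless because every atom is decidable, hence the semantics over ℤ is ¬¬-stable. Only T_m-atoms
-- produce T_m-atoms, so the translation preserves RQSPA⁻.

module Submission where

open import Defs
open import Data.Nat using (ℕ; zero; suc; z≤n; s≤s)
import Data.Nat.Properties as ℕP
open import Data.Integer using (ℤ; +_; -[1+_]; _+_; _-_; -_; _≤_; _<_; _⊓_; _⊔_; +≤+; +<+; -<+; -≤+)
import Data.Integer.Properties as ℤP
open import Data.Integer.Properties using () renaming (_≟_ to _≟ℤ_)
open import Data.Integer.Tactic.RingSolver using (solve-∀)
open import Data.Fin using (Fin; zero; suc)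
open import Data.Vec as V using (Vec; []; _∷_; lookup)
import Data.Vec.Properties as VP
open import Data.List as L using (List; []; _∷_; _++_; cartesianProductWith; upTo; allFin)
import Data.List.Properties as LP
open import Data.List.Membership.Propositional using (_∈_; _∉_)
open import Data.List.Membership.Propositional.Properties
open import Data.List.Membership.DecPropositional _≟ℤ_ using (_∈?_)
open import Data.List.Relation.Unary.Any using (here; there)
open import Data.Maybe using (Maybe; just; nothing)
open import Data.Maybe.Properties using (just-injective)
open import Data.Product using (Σ; ∃; ∃₂; _×_; _,_; proj₁; proj₂)
open import Data.Sum using (_⊎_; inj₁; inj₂; [_,_]′)
open import Data.Empty using (⊥-elim)
open import Function using (id)
open import Function.Bundles using (_⇔_; mk⇔; Equivalence)
open import Relation.Nullary using (¬_; yes; no; ¬?; Stable; negated-stable)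
open import Relation.Nullary.Decidable using (decidable-stable)
open import Relation.Binary.PropositionalEquality

map₂≡just⁻ : ∀ {A B C : Set} (f : A → B → C) mx my {c} → map₂ f mx my ≡ just c →
  ∃₂ λ a b → mx ≡ just a × my ≡ just b × f a b ≡ c
map₂≡just⁻ f (just a) (just b) refl = a , b , refl , refl , refl

bindM≡just⁻ : ∀ {A B : Set} mx (f : A → Maybe B) {b} → bindM mx f ≡ just b → ∃ λ a → mx ≡ just a × f a ≡ just b
bindM≡just⁻ (just a) f e = a , refl , e

mapM≡just⁻ : ∀ {A B : Set} (f : A → B) mx {b} → mapM f mx ≡ just b → ∃ λ a → mx ≡ just a × f a ≡ b
mapM≡just⁻ f (just a) refl = a , refl , refl

∈-map-++-map⁻ : ∀ {A B : Set} (f g : A → B) xs {y} → y ∈ L.map f xs ++ L.map g xs →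
  (∃ λ x → x ∈ xs × y ≡ f x) ⊎ (∃ λ x → x ∈ xs × y ≡ g x)
∈-map-++-map⁻ f g xs p with ∈-++⁻ (L.map f xs) p
... | inj₁ q = inj₁ (∈-map⁻ f q)
... | inj₂ q = inj₂ (∈-map⁻ g q)

module _ {A B : Set} (f : A → Maybe B) where

  ∈-mapMaybe⁺ : ∀ {x y xs} → x ∈ xs → f x ≡ just y → y ∈ L.mapMaybe f xs
  ∈-mapMaybe⁺ {xs = x ∷ xs} (here refl) e rewrite e = here refl
  ∈-mapMaybe⁺ {xs = x ∷ xs} (there p) e with f x
  ... | nothing = ∈-mapMaybe⁺ p e
  ... | just _ = there (∈-mapMaybe⁺ p e)

  ∈-mapMaybe⁻ : ∀ xs {y} → y ∈ L.mapMaybe f xs → ∃ λ x → x ∈ xs × f x ≡ just y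
  ∈-mapMaybe⁻ (x ∷ xs) p with f x in e | p
  ... | nothing | q = let x' , x'∈ , e' = ∈-mapMaybe⁻ xs q in x' , there x'∈ , e'
  ... | just y | here refl = x , here refl , e
  ... | just y | there q = let x' , x'∈ , e' = ∈-mapMaybe⁻ xs q in x' , there x'∈ , e'

IsMin IsMax : ℤ → List ℤ → Set
IsMin m xs = m ∈ xs × (∀ {y} → y ∈ xs → m ≤ y)
IsMax m xs = m ∈ xs × (∀ {y} → y ∈ xs → y ≤ m)

minL≡nothing⇒[] : ∀ xs → minL xs ≡ nothing → xs ≡ []
minL≡nothing⇒[] [] e = refl
minL≡nothing⇒[] (x ∷ xs) e with minL xs
minL≡nothing⇒[] (x ∷ xs) () | nothing
minL≡nothing⇒[] (x ∷ xs) () | just y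

maxL≡nothing⇒[] : ∀ xs → maxL xs ≡ nothing → xs ≡ []
maxL≡nothing⇒[] [] e = refl
maxL≡nothing⇒[] (x ∷ xs) e with maxL xs
maxL≡nothing⇒[] (x ∷ xs) () | nothing
maxL≡nothing⇒[] (x ∷ xs) () | just y

∈-sel : ∀ {x y : ℤ} {xs} (x∘y : ℤ) → x∘y ≡ x ⊎ x∘y ≡ y → y ∈ xs → x∘y ∈ x ∷ xs
∈-sel _ (inj₁ refl) _ = here refl
∈-sel _ (inj₂ refl) y∈ = there y∈

minL-sound : ∀ xs {m} → minL xs ≡ just m → IsMin m xs
minL-sound (x ∷ xs) e with minL xs in eq
minL-sound (x ∷ xs) refl | nothing rewrite minL≡nothing⇒[] xs eq =
  here refl , λ { (here refl) → ℤP.≤-refl }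
minL-sound (x ∷ xs) refl | just y with minL-sound xs eq
... | y∈ , y≤ = ∈-sel (x ⊓ y) (ℤP.⊓-sel x y) y∈ , λ
  { (here refl) → ℤP.i⊓j≤i x y
  ; (there p) → ℤP.≤-trans (ℤP.i⊓j≤j x y) (y≤ p) }

maxL-sound : ∀ xs {m} → maxL xs ≡ just m → IsMax m xs
maxL-sound (x ∷ xs) e with maxL xs in eq
maxL-sound (x ∷ xs) refl | nothing rewrite maxL≡nothing⇒[] xs eq =
  here refl , λ { (here refl) → ℤP.≤-refl }
maxL-sound (x ∷ xs) refl | just y with maxL-sound xs eq
... | y∈ , ≤y = ∈-sel (x ⊔ y) (ℤP.⊔-sel x y) y∈ , λ
  { (here refl) → ℤP.i≤i⊔j x y
  ; (there p) → ℤP.≤-trans (≤y p) (ℤP.i≤j⊔i x y) }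

minL-complete : ∀ xs {m} → IsMin m xs → minL xs ≡ just m
minL-complete xs (m∈ , m≤) with minL xs in eq
... | just m' = cong just (ℤP.≤-antisym (proj₂ (minL-sound xs eq) m∈) (m≤ (proj₁ (minL-sound xs eq))))
... | nothing with minL≡nothing⇒[] xs eq
minL-complete [] (() , _) | nothing | refl

maxL-complete : ∀ xs {m} → IsMax m xs → maxL xs ≡ just m
maxL-complete xs (m∈ , ≤m) with maxL xs in eq
... | just m' = cong just (ℤP.≤-antisym (≤m (proj₁ (maxL-sound xs eq))) (proj₂ (maxL-sound xs eq) m∈))
... | nothing with maxL≡nothing⇒[] xs eq
maxL-complete [] (() , _) | nothing | refl

minL-cong : ∀ A B → (∀ {z} → z ∈ A → z ∈ B) → (∀ {z} → z ∈ B → z ∈ A) → minL A ≡ minL B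
minL-cong A B A⊆B B⊆A with minL A in eA
... | just m = let m∈ , m≤ = minL-sound A eA in sym (minL-complete B (A⊆B m∈ , λ p → m≤ (B⊆A p)))
... | nothing with minL B in eB
... | nothing = refl
... | just m with minL≡nothing⇒[] A eA
... | refl with B⊆A (proj₁ (minL-sound B eB))
... | ()

maxL-∷ : ∀ x xs → ∃ λ m → maxL (x ∷ xs) ≡ just m
maxL-∷ x xs with maxL (x ∷ xs) in e
... | just m = m , refl
... | nothing with () ← maxL≡nothing⇒[] (x ∷ xs) e

-- Sign splitting of finite sets of integers

record SignSplit (A P N : List ℤ) : Set where
  field
    pos-sound    : ∀ {z} → z ∈ P → z ∈ A × + 0 ≤ z
    pos-complete : ∀ {z} → z ∈ A → + 0 ≤ z → z ∈ P
    neg-sound    : ∀ {z} → z ∈ N → - z ∈ A × + 0 < z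
    neg-complete : ∀ {z} → z ∈ A → z < + 0 → - z ∈ N
open SignSplit

∈-∩L⁻ : ∀ {z} A B → z ∈ A ∩L B → z ∈ A × z ∈ B
∈-∩L⁻ A B = ∈-filter⁻ (_∈? B)

∈-∩L⁺ : ∀ {z} A B → z ∈ A → z ∈ B → z ∈ A ∩L B
∈-∩L⁺ A B = ∈-filter⁺ (_∈? B)

∈-∖L⁻ : ∀ {z} A B → z ∈ A ∖L B → z ∈ A × z ∉ B
∈-∖L⁻ A B = ∈-filter⁻ (λ z → ¬? (z ∈? B))

∈-∖L⁺ : ∀ {z} A B → z ∈ A → z ∉ B → z ∈ A ∖L B
∈-∖L⁺ A B = ∈-filter⁺ (λ z → ¬? (z ∈? B))

∈-neg-neg : ∀ {z : ℤ} {A} → - - z ∈ A → z ∈ A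
∈-neg-neg {z} rewrite ℤP.neg-involutive z = λ p → p

0<z⇒-z<0 : ∀ {z} → + 0 < z → - z < + 0
0<z⇒-z<0 {+ suc n} _ = -<+
0<z⇒-z<0 {+ zero} (+<+ ())

split-[] : SignSplit [] [] []
split-[] = record { pos-sound = λ () ; pos-complete = λ () ; neg-sound = λ () ; neg-complete = λ () }

split-++ : ∀ {A P N B P' N'} → SignSplit A P N → SignSplit B P' N' →
  SignSplit (A ++ B) (P ++ P') (N ++ N')
split-++ {A} {P} {N} s t = record
  { pos-sound = λ p → [ (λ q → ∈-++⁺ˡ (proj₁ (pos-sound s q)) , proj₂ (pos-sound s q))
                        , (λ q → ∈-++⁺ʳ A (proj₁ (pos-sound t q)) , proj₂ (pos-sound t q)) ]′ (∈-++⁻ P p)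
  ; pos-complete = λ p h →
      [ (λ q → ∈-++⁺ˡ (pos-complete s q h)) , (λ q → ∈-++⁺ʳ P (pos-complete t q h)) ]′ (∈-++⁻ A p)
  ; neg-sound = λ p → [ (λ q → ∈-++⁺ˡ (proj₁ (neg-sound s q)) , proj₂ (neg-sound s q))
                        , (λ q → ∈-++⁺ʳ A (proj₁ (neg-sound t q)) , proj₂ (neg-sound t q)) ]′ (∈-++⁻ N p)
  ; neg-complete = λ p h →
      [ (λ q → ∈-++⁺ˡ (neg-complete s q h)) , (λ q → ∈-++⁺ʳ N (neg-complete t q h)) ]′ (∈-++⁻ A p)
  }

split-∩L : ∀ {A P N B P' N'} → SignSplit A P N → SignSplit B P' N' →
  SignSplit (A ∩L B) (P ∩L P') (N ∩L N')
split-∩L {A} {P} {N} {B} {P'} {N'} s t = record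
  { pos-sound = λ p → let a , b = ∈-∩L⁻ P P' p in
      ∈-∩L⁺ A B (proj₁ (pos-sound s a)) (proj₁ (pos-sound t b)) , proj₂ (pos-sound s a)
  ; pos-complete = λ p h → let a , b = ∈-∩L⁻ A B p in ∈-∩L⁺ P P' (pos-complete s a h) (pos-complete t b h)
  ; neg-sound = λ p → let a , b = ∈-∩L⁻ N N' p in
      ∈-∩L⁺ A B (proj₁ (neg-sound s a)) (proj₁ (neg-sound t b)) , proj₂ (neg-sound s a)
  ; neg-complete = λ p h → let a , b = ∈-∩L⁻ A B p in ∈-∩L⁺ N N' (neg-complete s a h) (neg-complete t b h)
  }

split-∖L : ∀ {A P N B P' N'} → SignSplit A P N → SignSplit B P' N' →
  SignSplit (A ∖L B) (P ∖L P') (N ∖L N')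
split-∖L {A} {P} {N} {B} {P'} {N'} s t = record
  { pos-sound = λ p → let a , b = ∈-∖L⁻ P P' p ; a∈ , 0≤ = pos-sound s a in
      ∈-∖L⁺ A B a∈ (λ q → b (pos-complete t q 0≤)) , 0≤
  ; pos-complete = λ p h → let a , b = ∈-∖L⁻ A B p in
      ∈-∖L⁺ P P' (pos-complete s a h) (λ q → b (proj₁ (pos-sound t q)))
  ; neg-sound = λ p → let a , b = ∈-∖L⁻ N N' p ; a∈ , 0< = neg-sound s a in
      ∈-∖L⁺ A B a∈ (λ q → b (∈-neg-neg (neg-complete t q (0<z⇒-z<0 0<)))) , 0<
  ; neg-complete = λ p h → let a , b = ∈-∖L⁻ A B p in
      ∈-∖L⁺ N N' (neg-complete s a h) (λ q → b (∈-neg-neg (proj₁ (neg-sound t q))))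
  }

split-⊆ : ∀ {A P N B P' N'} → SignSplit A P N → SignSplit B P' N' →
  A ⊆L B → P ⊆L P' × N ⊆L N'
split-⊆ s t A⊆B =
  (λ z p → pos-complete t (A⊆B z (proj₁ (pos-sound s p))) (proj₂ (pos-sound s p))) ,
  (λ z p → ∈-neg-neg (neg-complete t (A⊆B (- z) (proj₁ (neg-sound s p))) (0<z⇒-z<0 (proj₂ (neg-sound s p)))))

split-⊆⁻ : ∀ {A P N B P' N'} → SignSplit A P N → SignSplit B P' N' →
  P ⊆L P' → N ⊆L N' → A ⊆L B
split-⊆⁻ s t P⊆P' N⊆N' (+ n) p = proj₁ (pos-sound t (P⊆P' (+ n) (pos-complete s p (+≤+ z≤n))))
split-⊆⁻ s t P⊆P' N⊆N' -[1+ n ] p = proj₁ (neg-sound t (N⊆N' _ (neg-complete s p -<+)))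

split-singleton : ∀ v → SignSplit (v ∷ [])
  ((+ encℤ⁺ v ∷ []) ∖L ((+ 0 ∷ []) ∖L (+ encℤ⁻ v ∷ []))) ((+ encℤ⁻ v ∷ []) ∖L (+ 0 ∷ []))
split-singleton (+ n) = record
  { pos-sound = λ { (here refl) → here refl , +≤+ z≤n }
  ; pos-complete = λ { (here refl) _ → here refl }
  ; neg-sound = λ ()
  ; neg-complete = λ { (here refl) (+<+ ()) }
  }
split-singleton -[1+ n ] = record
  { pos-sound = λ ()
  ; pos-complete = λ { (here refl) () }
  ; neg-sound = λ { (here refl) → here refl , +<+ (s≤s z≤n) }
  ; neg-complete = λ { (here refl) _ → here refl }
  }

split-nonneg : ∀ {A P z} → SignSplit A P [] → z ∈ A → + 0 ≤ z
split-nonneg {z = + n} s p = +≤+ z≤n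
split-nonneg {z = -[1+ n ]} s p with neg-complete s p -<+
... | ()

split-empty⁻ : ∀ {A} → SignSplit A [] [] → A ≡ []
split-empty⁻ {[]} s = refl
split-empty⁻ {z ∷ A} s with pos-complete s (here refl) (split-nonneg s (here refl))
... | ()

minL-split-nonneg : ∀ {A P} → SignSplit A P [] → minL A ≡ minL P
minL-split-nonneg s = minL-cong _ _ (λ p → pos-complete s p (split-nonneg s p)) (λ q → proj₁ (pos-sound s q))

minL-split-neg : ∀ {A P N m} → SignSplit A P N → maxL N ≡ just m → minL A ≡ just (- m)
minL-split-neg {A} {N = N} {m} s e = minL-complete A (proj₁ (neg-sound s m∈) , bound)
  where
  m∈ : m ∈ N
  m∈ = proj₁ (maxL-sound N e)
  bound : ∀ {y} → y ∈ A → - m ≤ y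
  bound {+ n} _ = ℤP.≤-trans (ℤP.neg-mono-≤ (ℤP.<⇒≤ (proj₂ (neg-sound s m∈)))) (+≤+ z≤n)
  bound { -[1+ n ]} p = ℤP.neg-mono-≤ (proj₂ (maxL-sound N e) (neg-complete s p -<+))

maxL-split-nonneg : ∀ {A P N m} → SignSplit A P N → maxL P ≡ just m → maxL A ≡ just m
maxL-split-nonneg {A} {P} {m = m} s e = maxL-complete A (proj₁ (pos-sound s m∈) , bound)
  where
  m∈ : m ∈ P
  m∈ = proj₁ (maxL-sound P e)
  bound : ∀ {y} → y ∈ A → y ≤ m
  bound {+ n} p = proj₂ (maxL-sound P e) (pos-complete s p (+≤+ z≤n))
  bound { -[1+ n ]} _ = ℤP.≤-trans -≤+ (proj₂ (pos-sound s m∈))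

maxL-split-neg : ∀ {A N m} → SignSplit A [] N → minL N ≡ just m → maxL A ≡ just (- m)
maxL-split-neg {A} {N} {m} s e = maxL-complete A (proj₁ (neg-sound s m∈) , bound)
  where
  m∈ : m ∈ N
  m∈ = proj₁ (minL-sound N e)
  bound : ∀ {y} → y ∈ A → y ≤ - m
  bound {+ n} p with pos-complete s p (+≤+ z≤n)
  ... | ()
  bound { -[1+ n ]} p = ℤP.neg-mono-≤ (proj₂ (minL-sound N e) (neg-complete s p -<+))

pos?≡just⁻ : ∀ z {n} → pos? z ≡ just n → z ≡ + n
pos?≡just⁻ (+ n) refl = refl

neg?≡just⁻ : ∀ z {n} → neg? z ≡ just n → z ≡ - (+ n) × + 0 < + n
neg?≡just⁻ -[1+ n ] refl = refl , +<+ (s≤s z≤n)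

split-encode : ∀ A → SignSplit A (L.map +_ (encSet⁺ A)) (L.map +_ (encSet⁻ A))
split-encode A = record
  { pos-sound = λ p → let _ , q , e = ∈-map⁻ +_ p ; x , x∈ , ex = ∈-mapMaybe⁻ pos? A q in
      subst (_∈ A) (trans (pos?≡just⁻ x ex) (sym e)) x∈ , subst (+ 0 ≤_) (sym e) (+≤+ z≤n)
  ; pos-complete = λ { {+ n} p _ → ∈-map⁺ +_ (∈-mapMaybe⁺ pos? p refl) }
  ; neg-sound = λ p → let n , q , e = ∈-map⁻ +_ p ; x , x∈ , ex = ∈-mapMaybe⁻ neg? A q
                          x≡ , 0<n = neg?≡just⁻ x ex in
      subst (λ z → - z ∈ A) (sym e) (subst (_∈ A) x≡ x∈) , subst (+ 0 <_) (sym e) 0<n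
  ; neg-complete = λ { { -[1+ n ]} p _ → ∈-map⁺ +_ (∈-mapMaybe⁺ neg? p refl) ; {+ n} p (+<+ ()) }
  }

joinSigns : List ℕ → List ℕ → List ℤ
joinSigns P N = L.map +_ P ++ L.map (λ n → - (+ n)) N

split-joinSigns : ∀ P N → 0 ∉ N → SignSplit (joinSigns P N) (L.map +_ P) (L.map +_ N)
split-joinSigns P N 0∉N = record
  { pos-sound = λ p → ∈-++⁺ˡ p , nonneg p
  ; pos-complete = pos-complete′
  ; neg-sound = neg-sound′
  ; neg-complete = neg-complete′
  }
  where
  nonneg : ∀ {z} → z ∈ L.map +_ P → + 0 ≤ z
  nonneg p with ∈-map⁻ +_ p
  ... | _ , _ , refl = +≤+ z≤n
  pos-complete′ : ∀ {z} → z ∈ joinSigns P N → + 0 ≤ z → z ∈ L.map +_ P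
  pos-complete′ p 0≤z with ∈-++⁻ (L.map +_ P) p
  ... | inj₁ q = q
  ... | inj₂ q with ∈-map⁻ _ q | 0≤z
  ... | zero , 0∈N , refl | _ = ⊥-elim (0∉N 0∈N)
  ... | suc n , _ , refl | ()
  neg-sound′ : ∀ {z} → z ∈ L.map +_ N → - z ∈ joinSigns P N × + 0 < z
  neg-sound′ p with ∈-map⁻ +_ p
  ... | zero , 0∈N , refl = ⊥-elim (0∉N 0∈N)
  ... | suc n , q , refl = ∈-++⁺ʳ (L.map +_ P) (∈-map⁺ _ q) , +<+ (s≤s z≤n)
  neg-complete′ : ∀ {z} → z ∈ joinSigns P N → z < + 0 → - z ∈ L.map +_ N
  neg-complete′ p z<0 with ∈-++⁻ (L.map +_ P) p
  ... | inj₂ q with ∈-map⁻ _ q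
  ...   | n , n∈ , refl rewrite ℤP.neg-involutive (+ n) = ∈-map⁺ +_ n∈
  neg-complete′ p z<0 | inj₁ q with ∈-map⁻ +_ q | z<0
  ... | n , _ , refl | +<+ ()

map-+-⊆⁻ : ∀ {P Q : List ℕ} → L.map +_ P ⊆L L.map +_ Q → ∀ z → z ∈ P → z ∈ Q
map-+-⊆⁻ h z p with ∈-map⁻ +_ (h (+ z) (∈-map⁺ +_ p))
... | _ , q , refl = q

_∼_ : List ℕ → List ℕ → Set
P ∼ Q = (z : ℕ) → (z ∈ P → z ∈ Q) × (z ∈ Q → z ∈ P)

split⇒∼encSet : ∀ {A P N} → SignSplit A (L.map +_ P) (L.map +_ N) → P ∼ encSet⁺ A × N ∼ encSet⁻ A
split⇒∼encSet {A} s =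
  let P⊆ , N⊆ = split-⊆ s (split-encode A) (λ _ a → a)
      ⊆P , ⊆N = split-⊆ (split-encode A) s (λ _ a → a)
  in (λ z → map-+-⊆⁻ P⊆ z , map-+-⊆⁻ ⊆P z) , (λ z → map-+-⊆⁻ N⊆ z , map-+-⊆⁻ ⊆N z)

encℤ-nonneg : ∀ {a} → + 0 ≤ a → a ≡ + encℤ⁺ a × + 0 ≡ + encℤ⁻ a
encℤ-nonneg {+ n} _ = refl , refl

encℤ-neg : ∀ {m} → + 0 < m → + 0 ≡ + encℤ⁺ (- m) × m ≡ + encℤ⁻ (- m)
encℤ-neg {+ suc n} _ = refl , refl
encℤ-neg {+ zero} (+<+ ())

encℤ⁺-encℤ⁻ : ∀ v → + encℤ⁺ v - + encℤ⁻ v ≡ v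
encℤ⁺-encℤ⁻ (+ n) = ℤP.+-identityʳ (+ n)
encℤ⁺-encℤ⁻ -[1+ n ] = refl

encℤ⁻≡0⇒ : ∀ v → + encℤ⁻ v ≡ + 0 → v ≡ + encℤ⁺ v
encℤ⁻≡0⇒ (+ n) _ = refl

encℤ⁺≡0⇒ : ∀ v → + encℤ⁺ v ≡ + 0 → v ≡ - (+ encℤ⁻ v)
encℤ⁺≡0⇒ (+ zero) _ = refl
encℤ⁺≡0⇒ -[1+ n ] _ = refl

joinInt : ℕ → ℕ → ℤ
joinInt p zero = + p
joinInt p (suc n) = -[1+ n ]

encℤ-joinInt : ∀ p n → p ≡ 0 ⊎ n ≡ 0 → encℤ⁺ (joinInt p n) ≡ p × encℤ⁻ (joinInt p n) ≡ n
encℤ-joinInt p zero _ = refl , refl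
encℤ-joinInt zero (suc n) _ = refl , refl
encℤ-joinInt (suc p) (suc n) (inj₁ ())
encℤ-joinInt (suc p) (suc n) (inj₂ ())

-- The translation

module _ {k l m : ℕ} where

  ⊥ᶠ ⊤ᶠ : Formula k l m
  ⊥ᶠ = sAtom ssubS ∅ ∅
  ⊤ᶠ = ¬ᶠ ⊥ᶠ

  ⋁ ⋀ : List (Formula k l m) → Formula k l m
  ⋁ [] = ⊥ᶠ
  ⋁ (φ ∷ φs) = ¬ᶠ ((¬ᶠ φ) ∧ᶠ (¬ᶠ ⋁ φs))
  ⋀ [] = ⊤ᶠ
  ⋀ (φ ∷ φs) = φ ∧ᶠ ⋀ φs

  _⇒ᶠ_ : Formula k l m → Formula k l m → Formula k l m
  φ ⇒ᶠ ψ = ¬ᶠ (φ ∧ᶠ (¬ᶠ ψ))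

ix⁺ ix⁻ : ∀ {k} → Fin k → Fin (double k)
ix⁺ zero = zero
ix⁺ (suc i) = suc (suc (ix⁺ i))
ix⁻ zero = suc zero
ix⁻ (suc i) = suc (suc (ix⁻ i))

data Guard (k l m : ℕ) : Set where
  empty nonempty defined : STerm k l m → Guard k l m

guardF : ∀ {k l m} → Guard k l m → Formula k l m
guardF (empty s) = sAtom subS s ∅
guardF (nonempty s) = sAtom ssupS s ∅
guardF (defined s) = sAtom subS s s

guardsF : ∀ {k l m} → List (Guard k l m) → Formula k l m
guardsF gs = ⋀ (L.map guardF gs)

weakenS : ∀ {k l m} → STerm k l 0 → STerm k l m
weakenI : ∀ {k l m} → ITerm k l 0 → ITerm k l m
weakenS ∅ = ∅
weakenS (fvar i) = fvar i
weakenS (sing t) = sing (weakenI t)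
weakenS (s ∪ₛ t) = weakenS s ∪ₛ weakenS t
weakenS (s ∩ₛ t) = weakenS s ∩ₛ weakenS t
weakenS (s ∖ₛ t) = weakenS s ∖ₛ weakenS t
weakenI (icst c) = icst c
weakenI (ivar i) = ivar i
weakenI (imin s) = imin (weakenS s)
weakenI (imax s) = imax (weakenS s)

weakenG : ∀ {k l m} → Guard k l 0 → Guard k l m
weakenG (empty s) = empty (weakenS s)
weakenG (nonempty s) = nonempty (weakenS s)
weakenG (defined s) = defined (weakenS s)

-- Under its guards, a case (gs , P , N) of a set term denotes the set with nonnegative part P
-- and negated negative part N; a case (gs , p , n) of an integer term denotes p - n with p = 0 or n = 0.
SetCase IntCase : ℕ → ℕ → ℕ → Set
SetCase k l m = List (Guard k l m) × STerm k l m × STerm k l m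
IntCase k l m = List (Guard k l m) × ITerm k l m × ITerm k l m

-- The set terms of a T_m-atom contain no bound set variables, so neither do its guards.
ArithCase : ℕ → ℕ → Set
ArithCase k l = List (Guard k l 0) × MTerm k l

extremumGuards : ∀ {k l m} → List (Guard k l m) → STerm k l m → STerm k l m → Guard k l m →
  List (Guard k l m)
extremumGuards gs P N g = gs ++ (defined P ∷ defined N ∷ g ∷ [])

module _ {k l m : ℕ} where

  0ᵢ : ITerm k l m
  0ᵢ = icst (+ 0)

  -- {p} ∖ ({0} ∖ {n}) is {p} if n = 0 and empty otherwise.
  singCase : IntCase k l m → SetCase k l m
  singCase (gs , p , n) = gs , (sing p ∖ₛ (sing 0ᵢ ∖ₛ sing n)) , (sing n ∖ₛ sing 0ᵢ)

  combineS : (STerm k l m → STerm k l m → STerm k l m) → SetCase k l m → SetCase k l m → SetCase k l m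
  combineS _⊙_ (gs₁ , P₁ , N₁) (gs₂ , P₂ , N₂) = gs₁ ++ gs₂ , P₁ ⊙ P₂ , N₁ ⊙ N₂

  minCase⁺ minCase⁻ maxCase⁺ maxCase⁻ : SetCase k l m → IntCase k l m
  minCase⁺ (gs , P , N) = extremumGuards gs P N (empty N) , imin P , 0ᵢ
  minCase⁻ (gs , P , N) = extremumGuards gs P N (nonempty N) , 0ᵢ , imax N
  maxCase⁺ (gs , P , N) = extremumGuards gs P N (nonempty P) , imax P , 0ᵢ
  maxCase⁻ (gs , P , N) = extremumGuards gs P N (empty P) , 0ᵢ , imin N

splitS : ∀ {k l m} → STerm k l m → List (SetCase (double k) (double l) (double m))
splitI : ∀ {k l m} → ITerm k l m → List (IntCase (double k) (double l) (double m))
splitS ∅ = ([] , ∅ , ∅) ∷ []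
splitS (fvar i) = ([] , fvar (ix⁺ i) , fvar (ix⁻ i)) ∷ []
splitS (bvar i) = ([] , bvar (ix⁺ i) , bvar (ix⁻ i)) ∷ []
splitS (sing t) = L.map singCase (splitI t)
splitS (s ∪ₛ t) = cartesianProductWith (combineS _∪ₛ_) (splitS s) (splitS t)
splitS (s ∩ₛ t) = cartesianProductWith (combineS _∩ₛ_) (splitS s) (splitS t)
splitS (s ∖ₛ t) = cartesianProductWith (combineS _∖ₛ_) (splitS s) (splitS t)
splitI (icst c) = ([] , icst (+ encℤ⁺ c) , icst (+ encℤ⁻ c)) ∷ []
splitI (ivar i) = ([] , ivar (ix⁺ i) , ivar (ix⁻ i)) ∷ []
splitI (imin s) = L.map minCase⁺ (splitS s) ++ L.map minCase⁻ (splitS s)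
splitI (imax s) = L.map maxCase⁺ (splitS s) ++ L.map maxCase⁻ (splitS s)

module _ {k l : ℕ} where

  minArith⁺ minArith⁻ maxArith⁺ maxArith⁻ : SetCase k l 0 → ArithCase k l
  minArith⁺ (gs , P , N) = extremumGuards gs P N (empty N) , mmin P
  minArith⁻ (gs , P , N) = extremumGuards gs P N (nonempty N) , mcst (+ 0) ⊖ mmax N
  maxArith⁺ (gs , P , N) = extremumGuards gs P N (nonempty P) , mmax P
  maxArith⁻ (gs , P , N) = extremumGuards gs P N (empty P) , mcst (+ 0) ⊖ mmin N

  combineM : (MTerm k l → MTerm k l → MTerm k l) → ArithCase k l → ArithCase k l → ArithCase k l
  combineM _⊙_ (gs₁ , a) (gs₂ , b) = gs₁ ++ gs₂ , a ⊙ b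

splitM : ∀ {k l} → MTerm k l → List (ArithCase (double k) (double l))
splitM (mcst c) = ([] , mcst c) ∷ []
splitM (mvar i) = ([] , mvar (ix⁺ i) ⊖ mvar (ix⁻ i)) ∷ []
splitM (mmax s) = L.map maxArith⁺ (splitS s) ++ L.map maxArith⁻ (splitS s)
splitM (mmin s) = L.map minArith⁺ (splitS s) ++ L.map minArith⁻ (splitS s)
splitM (s ⊕ t) = cartesianProductWith (combineM _⊕_) (splitM s) (splitM t)
splitM (s ⊖ t) = cartesianProductWith (combineM _⊖_) (splitM s) (splitM t)

flipR : IRel → IRel
flipR eqR = eqR
flipR leR = geR
flipR geR = leR

module _ {k l m : ℕ} where

  isZero isDefined : ITerm k l m → Formula k l m
  isZero t = iAtom eqR t 0ᵢ (+ 0)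
  isDefined t = iAtom eqR t t (+ 0)

  -- For natural a and b, a + b ≤ C iff a = j and b ≤ C - j for some j ≤ C.
  sumLeAt : ITerm k l m → ITerm k l m → ℕ → ℕ → Formula k l m
  sumLeAt a b C j = iAtom eqR a 0ᵢ (+ j) ∧ᶠ iAtom leR b 0ᵢ (+ C - + j)

  sumLe sumGe : ITerm k l m → ITerm k l m → ℤ → Formula k l m
  sumLe a b (+ C) = ⋁ (L.map (sumLeAt a b C) (upTo (suc C)))
  sumLe a b -[1+ n ] = ⊥ᶠ
  sumGe a b c = isDefined a ∧ᶠ (isDefined b ∧ᶠ (¬ᶠ sumLe a b (c - + 1)))

  sumRel : IRel → ITerm k l m → ITerm k l m → ℤ → Formula k l m
  sumRel leR a b c = sumLe a b c
  sumRel geR a b c = sumGe a b c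
  sumRel eqR a b c = sumLe a b c ∧ᶠ sumGe a b c

  -- (p₁ - n₁) r (p₂ - n₂) + c, by cases on which of p₁, n₁ and of p₂, n₂ vanish.
  intRelCases : IRel → ℤ → ITerm k l m → ITerm k l m → ITerm k l m → ITerm k l m → List (Formula k l m)
  intRelCases r c p₁ n₁ p₂ n₂ =
      (isZero n₁ ∧ᶠ (isZero n₂ ∧ᶠ iAtom r p₁ p₂ c))
    ∷ (isZero p₁ ∧ᶠ (isZero p₂ ∧ᶠ iAtom r n₂ n₁ c))
    ∷ (isZero n₁ ∧ᶠ (isZero p₂ ∧ᶠ sumRel r p₁ n₂ c))
    ∷ (isZero p₁ ∧ᶠ (isZero n₂ ∧ᶠ sumRel (flipR r) n₁ p₂ (- c)))
    ∷ []

  subsetF : STerm k l m → STerm k l m → Formula k l m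
  subsetF s t = sAtom subS s t

  setRel : SRel → STerm k l m → STerm k l m → STerm k l m → STerm k l m → Formula k l m
  setRel eqS P₁ N₁ P₂ N₂ = setRel subS P₁ N₁ P₂ N₂ ∧ᶠ setRel supS P₁ N₁ P₂ N₂
  setRel subS P₁ N₁ P₂ N₂ = subsetF P₁ P₂ ∧ᶠ subsetF N₁ N₂
  setRel supS P₁ N₁ P₂ N₂ = subsetF P₂ P₁ ∧ᶠ subsetF N₂ N₁
  setRel ssubS P₁ N₁ P₂ N₂ = setRel subS P₁ N₁ P₂ N₂ ∧ᶠ (¬ᶠ setRel supS P₁ N₁ P₂ N₂)
  setRel ssupS P₁ N₁ P₂ N₂ = setRel supS P₁ N₁ P₂ N₂ ∧ᶠ (¬ᶠ setRel subS P₁ N₁ P₂ N₂)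

  sAtomCase : SRel → SetCase k l m → SetCase k l m → Formula k l m
  sAtomCase r (gs₁ , P₁ , N₁) (gs₂ , P₂ , N₂) = guardsF gs₁ ∧ᶠ (guardsF gs₂ ∧ᶠ setRel r P₁ N₁ P₂ N₂)

  iAtomCase : IRel → ℤ → IntCase k l m → IntCase k l m → Formula k l m
  iAtomCase r c (gs₁ , p₁ , n₁) (gs₂ , p₂ , n₂) =
    guardsF gs₁ ∧ᶠ (guardsF gs₂ ∧ᶠ
      ((isDefined p₁ ∧ᶠ (isDefined n₁ ∧ᶠ (isDefined p₂ ∧ᶠ isDefined n₂))) ∧ᶠ
       ⋁ (intRelCases r c p₁ n₁ p₂ n₂)))

  mAtomCase : IRel → ArithCase k l → Formula k l m
  mAtomCase r (gs , t) = guardsF (L.map weakenG gs) ∧ᶠ mAtom r t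

  -- A pair of naturals encodes an integer only if one of them is 0, and a pair of sets
  -- encodes a set only if 0 is not in the negative part.
  validPair : ITerm k l m → ITerm k l m → Formula k l m
  validPair p n = ⋁ (isZero p ∷ isZero n ∷ [])

  zeroFree : STerm k l m → Formula k l m
  zeroFree N = ¬ᶠ subsetF (sing 0ᵢ) N

translate : ∀ {k l m} → Formula k l m → Formula (double k) (double l) (double m)
translate (sAtom r s t) = ⋁ (cartesianProductWith (sAtomCase r) (splitS s) (splitS t))
translate (iAtom r s t c) = ⋁ (cartesianProductWith (iAtomCase r c) (splitI s) (splitI t))
translate (mAtom r t) = ⋁ (L.map (mAtomCase r) (splitM t))
translate (φ ∧ᶠ ψ) = translate φ ∧ᶠ translate ψ
translate (¬ᶠ φ) = ¬ᶠ translate φ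
translate (∀ᵢ φ) = ∀ᵢ (∀ᵢ (validPair (ivar zero) (ivar (suc zero)) ⇒ᶠ translate φ))
translate (∀ₛ φ) = ∀ₛ (∀ₛ (zeroFree (bvar (suc zero)) ⇒ᶠ translate φ))

-- Stability and the derived connectives

×-stable : ∀ {X Y : Set} → Stable X → Stable Y → Stable (X × Y)
×-stable sx sy ¬¬xy = sx (λ ¬x → ¬¬xy (λ xy → ¬x (proj₁ xy))) , sy (λ ¬y → ¬¬xy (λ xy → ¬y (proj₂ xy)))

just-stable : ∀ {X : Set} (mx : Maybe X) (H : X → Set) → (∀ a → Stable (H a)) →
  Stable (Σ X λ a → mx ≡ just a × H a)
just-stable (just a) H st ¬¬h = a , refl , st a (λ ¬h → ¬¬h λ { (_ , refl , h) → ¬h h })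
just-stable nothing H st ¬¬h = ⊥-elim (¬¬h λ { (_ , () , _) })

just₂-stable : ∀ {X Y : Set} (mx : Maybe X) (my : Maybe Y) (H : X → Y → Set) → (∀ a b → Stable (H a b)) →
  Stable (Σ X λ a → Σ Y λ b → mx ≡ just a × my ≡ just b × H a b)
just₂-stable (just a) my H st ¬¬h =
  let b , eb , h = just-stable my (H a) (st a) (λ ¬h → ¬¬h λ { (_ , b , refl , eb , h) → ¬h (b , eb , h) }) in
  a , b , refl , eb , h
just₂-stable nothing my H st ¬¬h = ⊥-elim (¬¬h λ { (_ , _ , () , _) })

⊆L-stable : ∀ A B → Stable (A ⊆L B)
⊆L-stable A B ¬¬A⊆B z z∈A = decidable-stable (z ∈? B) (λ z∉B → ¬¬A⊆B (λ A⊆B → z∉B (A⊆B z z∈A)))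

holdsS-stable : ∀ r A B → Stable (holdsS r A B)
holdsS-stable eqS A B = ×-stable (⊆L-stable A B) (⊆L-stable B A)
holdsS-stable subS A B = ⊆L-stable A B
holdsS-stable supS A B = ⊆L-stable B A
holdsS-stable ssubS A B = ×-stable (⊆L-stable A B) negated-stable
holdsS-stable ssupS A B = ×-stable (⊆L-stable B A) negated-stable

holdsI-stable : ∀ r a b → Stable (holdsI r a b)
holdsI-stable eqR a b = decidable-stable (a ≟ℤ b)
holdsI-stable leR a b = decidable-stable (a ℤP.≤? b)
holdsI-stable geR a b = decidable-stable (b ℤP.≤? a)

module Derived (D : Set) (ι : D → ℤ) where
  open Sem D ι

  ⟦⟧-stable : ∀ {k l m} (φ : Formula k l m) xs Fs Bs → Stable (⟦ φ ⟧ xs Fs Bs)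
  ⟦⟧-stable (sAtom r s t) xs Fs Bs = just₂-stable _ _ (holdsS r) (holdsS-stable r)
  ⟦⟧-stable (iAtom r s t c) xs Fs Bs = just₂-stable _ _ (λ a b → holdsI r a (b + c)) (λ a b → holdsI-stable r a (b + c))
  ⟦⟧-stable (mAtom r t) xs Fs Bs = just-stable _ (λ a → holdsI r a (+ 0)) (λ a → holdsI-stable r a (+ 0))
  ⟦⟧-stable (φ ∧ᶠ ψ) xs Fs Bs = ×-stable (⟦⟧-stable φ xs Fs Bs) (⟦⟧-stable ψ xs Fs Bs)
  ⟦⟧-stable (¬ᶠ φ) xs Fs Bs = negated-stable
  ⟦⟧-stable (∀ᵢ φ) xs Fs Bs ¬¬h d = ⟦⟧-stable φ (ι d ∷ xs) Fs Bs (λ ¬h → ¬¬h (λ h → ¬h (h d)))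
  ⟦⟧-stable (∀ₛ φ) xs Fs Bs ¬¬h A = ⟦⟧-stable φ xs Fs (L.map ι A ∷ Bs) (λ ¬h → ¬¬h (λ h → ¬h (h A)))

  module At {k l m} (xs : Vec ℤ k) (Fs : Vec (List ℤ) l) (Bs : Vec (List ℤ) m) where

    ⊤ᶠ-intro : ⟦ ⊤ᶠ {k} {l} {m} ⟧ xs Fs Bs
    ⊤ᶠ-intro (_ , _ , refl , refl , _ , ∅⊈∅) = ∅⊈∅ (λ _ ())

    ⊥ᶠ-elim : ¬ ⟦ ⊥ᶠ {k} {l} {m} ⟧ xs Fs Bs
    ⊥ᶠ-elim = ⊤ᶠ-intro

    ⋁-intro : ∀ {φ φs} → φ ∈ φs → ⟦ φ ⟧ xs Fs Bs → ⟦ ⋁ φs ⟧ xs Fs Bs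
    ⋁-intro (here refl) h (¬h , _) = ¬h h
    ⋁-intro (there p) h (_ , ¬hs) = ¬hs (⋁-intro p h)

    ⋁-elim : ∀ φs → ⟦ ⋁ φs ⟧ xs Fs Bs → ¬ ¬ (∃ λ φ → φ ∈ φs × ⟦ φ ⟧ xs Fs Bs)
    ⋁-elim [] h _ = ⊥ᶠ-elim h
    ⋁-elim (φ ∷ φs) h ¬∃ =
      h ((λ hφ → ¬∃ (φ , here refl , hφ)) , λ hs → ⋁-elim φs hs (λ { (ψ , p , hψ) → ¬∃ (ψ , there p , hψ) }))

    ⋁-elim-stable : ∀ φs {X : Set} → Stable X → (∀ {φ} → φ ∈ φs → ⟦ φ ⟧ xs Fs Bs → X) →
      ⟦ ⋁ φs ⟧ xs Fs Bs → X
    ⋁-elim-stable φs stX f h = stX (λ ¬x → ⋁-elim φs h (λ { (φ , p , hφ) → ¬x (f p hφ) }))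

    ⋀-intro : ∀ φs → (∀ {φ} → φ ∈ φs → ⟦ φ ⟧ xs Fs Bs) → ⟦ ⋀ φs ⟧ xs Fs Bs
    ⋀-intro [] f = ⊤ᶠ-intro
    ⋀-intro (φ ∷ φs) f = f (here refl) , ⋀-intro φs (λ p → f (there p))

    ⋀-elim : ∀ φs → ⟦ ⋀ φs ⟧ xs Fs Bs → ∀ {φ} → φ ∈ φs → ⟦ φ ⟧ xs Fs Bs
    ⋀-elim (φ ∷ φs) (h , _) (here refl) = h
    ⋀-elim (φ ∷ φs) (_ , hs) (there p) = ⋀-elim φs hs p

    guardsF-++⁻ : ∀ gs₁ gs₂ → ⟦ guardsF (gs₁ ++ gs₂) ⟧ xs Fs Bs →
      ⟦ guardsF gs₁ ⟧ xs Fs Bs × ⟦ guardsF gs₂ ⟧ xs Fs Bs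
    guardsF-++⁻ [] gs₂ h = ⊤ᶠ-intro , h
    guardsF-++⁻ (g ∷ gs₁) gs₂ (hg , h) = let h₁ , h₂ = guardsF-++⁻ gs₁ gs₂ h in (hg , h₁) , h₂

    guardsF-++⁺ : ∀ gs₁ gs₂ → ⟦ guardsF gs₁ ⟧ xs Fs Bs → ⟦ guardsF gs₂ ⟧ xs Fs Bs →
      ⟦ guardsF (gs₁ ++ gs₂) ⟧ xs Fs Bs
    guardsF-++⁺ [] gs₂ _ h₂ = h₂
    guardsF-++⁺ (g ∷ gs₁) gs₂ (hg , h₁) h₂ = hg , guardsF-++⁺ gs₁ gs₂ h₁ h₂

    Defined : ∀ {X : Set} → Maybe X → Set
    Defined {X} mx = ∃ λ (x : X) → mx ≡ just x

    extremumGuards⁻ : ∀ gs P N g → ⟦ guardsF (extremumGuards gs P N g) ⟧ xs Fs Bs →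
      ⟦ guardsF gs ⟧ xs Fs Bs × Defined (evalS P xs Fs Bs) × Defined (evalS N xs Fs Bs) × ⟦ guardF g ⟧ xs Fs Bs
    extremumGuards⁻ gs P N g h =
      let hgs , (_ , _ , eP , _) , (_ , _ , eN , _) , hg , _ = guardsF-++⁻ gs (defined P ∷ defined N ∷ g ∷ []) h in
      hgs , (_ , eP) , (_ , eN) , hg

    extremumGuards⁺ : ∀ gs P N g {A B} → ⟦ guardsF gs ⟧ xs Fs Bs → evalS P xs Fs Bs ≡ just A →
      evalS N xs Fs Bs ≡ just B → ⟦ guardF g ⟧ xs Fs Bs → ⟦ guardsF (extremumGuards gs P N g) ⟧ xs Fs Bs
    extremumGuards⁺ gs P N g hgs eP eN hg =
      guardsF-++⁺ gs (defined P ∷ defined N ∷ g ∷ []) hgs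
        ((_ , _ , eP , eP , λ _ p → p) , (_ , _ , eN , eN , λ _ p → p) , hg , ⊤ᶠ-intro)

    empty⁻ : ∀ s → ⟦ guardF (empty s) ⟧ xs Fs Bs → evalS s xs Fs Bs ≡ just []
    empty⁻ s ([] , _ , e , refl , _) = e
    empty⁻ s (x ∷ _ , _ , e , refl , h) with h x (here refl)
    ... | ()

    empty⁺ : ∀ s → evalS s xs Fs Bs ≡ just [] → ⟦ guardF (empty s) ⟧ xs Fs Bs
    empty⁺ s e = [] , [] , e , refl , λ _ ()

    nonempty⁺ : ∀ s {x A} → evalS s xs Fs Bs ≡ just (x ∷ A) → ⟦ guardF (nonempty s) ⟧ xs Fs Bs
    nonempty⁺ s e = _ , [] , e , refl , (λ _ ()) , λ h → ∉[] (h _ (here refl))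

holdsI-shift : ∀ r {x y x' y'} d → holdsI r x y → x + d ≡ x' → y + d ≡ y' → holdsI r x' y'
holdsI-shift eqR d refl refl refl = refl
holdsI-shift leR d x≤y refl refl = ℤP.+-monoˡ-≤ d x≤y
holdsI-shift geR d x≥y refl refl = ℤP.+-monoˡ-≤ d x≥y

holdsI-flip⁻ : ∀ r {x y} → holdsI (flipR r) x y → holdsI r y x
holdsI-flip⁻ eqR = sym
holdsI-flip⁻ leR h = h
holdsI-flip⁻ geR h = h

holdsI-flip⁺ : ∀ r {x y} → holdsI r y x → holdsI (flipR r) x y
holdsI-flip⁺ eqR = sym
holdsI-flip⁺ leR h = h
holdsI-flip⁺ geR h = h

holdsI-neg⁺ : ∀ r α β c → holdsI r β (α + c) → holdsI r (- α) (- β + c)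
holdsI-neg⁺ r α β c h = holdsI-shift r (- α - β) h (lhs α β) (rhs α β c)
  where
  lhs : ∀ α β → β + (- α - β) ≡ - α
  lhs = solve-∀
  rhs : ∀ α β c → α + c + (- α - β) ≡ - β + c
  rhs = solve-∀

holdsI-neg⁻ : ∀ r α β c → holdsI r (- α) (- β + c) → holdsI r β (α + c)
holdsI-neg⁻ r α β c h = holdsI-shift r (α + β) h (lhs α β) (rhs α β c)
  where
  lhs : ∀ α β → - α + (α + β) ≡ β
  lhs = solve-∀
  rhs : ∀ α β c → - β + c + (α + β) ≡ α + c
  rhs = solve-∀

holdsI-sum⁺ : ∀ r α β c → holdsI r (α + β) c → holdsI r α (- β + c)
holdsI-sum⁺ r α β c h = holdsI-shift r (- β) h (lhs α β) (rhs β c)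
  where
  lhs : ∀ α β → α + β - β ≡ α
  lhs = solve-∀
  rhs : ∀ β c → c - β ≡ - β + c
  rhs = solve-∀

holdsI-sum⁻ : ∀ r α β c → holdsI r α (- β + c) → holdsI r (α + β) c
holdsI-sum⁻ r α β c h = holdsI-shift r β h refl (rhs β c)
  where
  rhs : ∀ β c → - β + c + β ≡ c
  rhs = solve-∀

holdsI-flip-sum⁺ : ∀ r α β c → holdsI (flipR r) (α + β) (- c) → holdsI r (- α) (β + c)
holdsI-flip-sum⁺ r α β c h = holdsI-shift r (c - α) (holdsI-flip⁻ r h) (lhs α c) (rhs α β c)
  where
  lhs : ∀ α c → - c + (c - α) ≡ - α
  lhs = solve-∀
  rhs : ∀ α β c → α + β + (c - α) ≡ β + c
  rhs = solve-∀

holdsI-flip-sum⁻ : ∀ r α β c → holdsI r (- α) (β + c) → holdsI (flipR r) (α + β) (- c)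
holdsI-flip-sum⁻ r α β c h = holdsI-flip⁺ r (holdsI-shift r (α - c) h (lhs α c) (rhs α β c))
  where
  lhs : ∀ α c → - α + (α - c) ≡ - c
  lhs = solve-∀
  rhs : ∀ α β c → β + c + (α - c) ≡ α + β
  rhs = solve-∀

evalS-weakenS : ∀ {k l m} (s : STerm k l 0) xs Fs (Bs : Vec (List ℤ) m) →
  evalS (weakenS s) xs Fs Bs ≡ evalS s xs Fs []
evalI-weakenI : ∀ {k l m} (t : ITerm k l 0) xs Fs (Bs : Vec (List ℤ) m) →
  evalI (weakenI t) xs Fs Bs ≡ evalI t xs Fs []
evalS-weakenS ∅ xs Fs Bs = refl
evalS-weakenS (fvar i) xs Fs Bs = refl
evalS-weakenS (sing t) xs Fs Bs = cong (mapM (_∷ [])) (evalI-weakenI t xs Fs Bs)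
evalS-weakenS (s ∪ₛ t) xs Fs Bs = cong₂ (map₂ _++_) (evalS-weakenS s xs Fs Bs) (evalS-weakenS t xs Fs Bs)
evalS-weakenS (s ∩ₛ t) xs Fs Bs = cong₂ (map₂ _∩L_) (evalS-weakenS s xs Fs Bs) (evalS-weakenS t xs Fs Bs)
evalS-weakenS (s ∖ₛ t) xs Fs Bs = cong₂ (map₂ _∖L_) (evalS-weakenS s xs Fs Bs) (evalS-weakenS t xs Fs Bs)
evalI-weakenI (icst c) xs Fs Bs = refl
evalI-weakenI (ivar i) xs Fs Bs = refl
evalI-weakenI (imin s) xs Fs Bs = cong (λ A → bindM A minL) (evalS-weakenS s xs Fs Bs)
evalI-weakenI (imax s) xs Fs Bs = cong (λ A → bindM A maxL) (evalS-weakenS s xs Fs Bs)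

module OverNat {K L M : ℕ} (Xs : Vec ℤ K) (Gs : Vec (List ℤ) L) (Cs : Vec (List ℤ) M) where
  open Sem ℕ +_
  open Derived ℕ +_
  open At Xs Gs Cs

  ⟦_⟧ₙ : Formula K L M → Set
  ⟦ φ ⟧ₙ = ⟦ φ ⟧ Xs Gs Cs

  valI : ITerm K L M → Maybe ℤ
  valI t = evalI t Xs Gs Cs

  valS : STerm K L M → Maybe (List ℤ)
  valS s = evalS s Xs Gs Cs

  isZero⁺ : ∀ t → valI t ≡ just (+ 0) → ⟦ isZero t ⟧ₙ
  isZero⁺ t e = _ , _ , e , refl , refl

  isZero⁻ : ∀ t {u} → valI t ≡ just u → ⟦ isZero t ⟧ₙ → u ≡ + 0
  isZero⁻ t e (_ , _ , e' , refl , u≡0) with refl ← just-injective (trans (sym e) e') = u≡0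

  isDefined⁺ : ∀ t {u} → valI t ≡ just u → ⟦ isDefined t ⟧ₙ
  isDefined⁺ t e = _ , _ , e , e , sym (ℤP.+-identityʳ _)

  sumLe-sound : ∀ a b c {x y} → valI a ≡ just x → valI b ≡ just y → ⟦ sumLe a b c ⟧ₙ → x + y ≤ c
  sumLe-sound a b -[1+ n ] _ _ h = ⊥-elim (⊥ᶠ-elim h)
  sumLe-sound a b (+ C) {x} {y} ea eb =
    ⋁-elim-stable (L.map (sumLeAt a b C) (upTo (suc C))) (decidable-stable (x + y ℤP.≤? + C)) bound
    where
    total : ∀ (j C : ℤ) → + 0 + j + (+ 0 + (C - j)) ≡ C
    total = solve-∀
    bound : ∀ {φ} → φ ∈ L.map (sumLeAt a b C) (upTo (suc C)) → ⟦ φ ⟧ₙ → x + y ≤ + C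
    bound p hφ with ∈-map⁻ (sumLeAt a b C) p
    ... | j , _ , refl with hφ
    ... | (_ , _ , ea' , refl , x≡) , (_ , _ , eb' , refl , y≤)
      with refl ← just-injective (trans (sym ea) ea') | refl ← just-injective (trans (sym eb) eb') =
      subst (x + y ≤_) (total (+ j) (+ C)) (ℤP.+-mono-≤ (ℤP.≤-reflexive x≡) y≤)

  sumLe-complete : ∀ a b {x y : ℕ} c → valI a ≡ just (+ x) → valI b ≡ just (+ y) → + x + + y ≤ c →
    ⟦ sumLe a b c ⟧ₙ
  sumLe-complete a b {x} {y} (+ C) ea eb (+≤+ x+y≤C) =
    ⋁-intro (∈-map⁺ (sumLeAt a b C) (∈-upTo⁺ (s≤s (ℕP.m+n≤o⇒m≤o x x+y≤C))))
      ((_ , _ , ea , refl , refl) , (_ , _ , eb , refl , y≤))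
    where
    lhs : ∀ (x y : ℤ) → x + y - x ≡ y
    lhs = solve-∀
    rhs : ∀ (x C : ℤ) → C - x ≡ + 0 + (C - x)
    rhs = solve-∀
    y≤ : + y ≤ + 0 + (+ C - + x)
    y≤ = holdsI-shift leR (- (+ x)) (+≤+ x+y≤C) (lhs (+ x) (+ y)) (rhs (+ x) (+ C))

  sumGe-complete : ∀ a b {x y : ℕ} c → valI a ≡ just (+ x) → valI b ≡ just (+ y) → c ≤ + x + + y →
    ⟦ sumGe a b c ⟧ₙ
  sumGe-complete a b c ea eb c≤x+y =
    isDefined⁺ a ea , isDefined⁺ b eb , λ h →
      ℤP.<-irrefl refl (ℤP.i≤pred[j]⇒i<j (subst (c ≤_) (pred≡ c) (ℤP.≤-trans c≤x+y (sumLe-sound a b (c - + 1) ea eb h))))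
    where
    pred≡ : ∀ c → c - + 1 ≡ -[1+ 0 ] + c
    pred≡ = solve-∀

  sumGe-sound : ∀ a b {x y : ℕ} c → valI a ≡ just (+ x) → valI b ≡ just (+ y) → ⟦ sumGe a b c ⟧ₙ →
    c ≤ + x + + y
  sumGe-sound a b {x} {y} c ea eb (_ , _ , ¬le) with + x + + y ℤP.≤? c - + 1
  ... | yes le = ⊥-elim (¬le (sumLe-complete a b (c - + 1) ea eb le))
  ... | no ¬le′ = subst (_≤ + x + + y) (suc-pred c) (ℤP.i<j⇒suc[i]≤j (ℤP.≰⇒> ¬le′))
    where
    suc-pred : ∀ c → + 1 + (c - + 1) ≡ c
    suc-pred = solve-∀

  sumRel-complete : ∀ r a b {x y : ℕ} c → valI a ≡ just (+ x) → valI b ≡ just (+ y) →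
    holdsI r (+ x + + y) c → ⟦ sumRel r a b c ⟧ₙ
  sumRel-complete leR a b c ea eb h = sumLe-complete a b c ea eb h
  sumRel-complete geR a b c ea eb h = sumGe-complete a b c ea eb h
  sumRel-complete eqR a b c ea eb h =
    sumLe-complete a b c ea eb (ℤP.≤-reflexive h) , sumGe-complete a b c ea eb (ℤP.≤-reflexive (sym h))

  sumRel-sound : ∀ r a b {x y : ℕ} c → valI a ≡ just (+ x) → valI b ≡ just (+ y) →
    ⟦ sumRel r a b c ⟧ₙ → holdsI r (+ x + + y) c
  sumRel-sound leR a b c ea eb h = sumLe-sound a b c ea eb h
  sumRel-sound geR a b c ea eb h = sumGe-sound a b c ea eb h
  sumRel-sound eqR a b c ea eb (le , ge) = ℤP.≤-antisym (sumLe-sound a b c ea eb le) (sumGe-sound a b c ea eb ge)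

  Encodes : ITerm K L M → ITerm K L M → ℤ → Set
  Encodes p n v = valI p ≡ just (+ encℤ⁺ v) × valI n ≡ just (+ encℤ⁻ v)

  module _ (r : IRel) (c : ℤ) (p₁ n₁ p₂ n₂ : ITerm K L M) where

    private
      cases : List (Formula K L M)
      cases = intRelCases r c p₁ n₁ p₂ n₂

    intRel-complete : ∀ v w → Encodes p₁ n₁ v → Encodes p₂ n₂ w →
      holdsI r v (w + c) → ⟦ ⋁ cases ⟧ₙ
    intRel-complete (+ x) (+ y) (ep₁ , en₁) (ep₂ , en₂) h = ⋁-intro {φs = cases} (here refl)
      (isZero⁺ n₁ en₁ , isZero⁺ n₂ en₂ , (_ , _ , ep₁ , ep₂ , h))
    intRel-complete -[1+ x ] -[1+ y ] (ep₁ , en₁) (ep₂ , en₂) h = ⋁-intro {φs = cases} (there (here refl))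
      (isZero⁺ p₁ ep₁ , isZero⁺ p₂ ep₂ , (_ , _ , en₂ , en₁ , holdsI-neg⁻ r (+ suc x) (+ suc y) c h))
    intRel-complete (+ x) -[1+ y ] (ep₁ , en₁) (ep₂ , en₂) h = ⋁-intro {φs = cases} (there (there (here refl)))
      (isZero⁺ n₁ en₁ , isZero⁺ p₂ ep₂ , sumRel-complete r p₁ n₂ c ep₁ en₂ (holdsI-sum⁻ r (+ x) (+ suc y) c h))
    intRel-complete -[1+ x ] (+ y) (ep₁ , en₁) (ep₂ , en₂) h = ⋁-intro {φs = cases} (there (there (there (here refl))))
      (isZero⁺ p₁ ep₁ , isZero⁺ n₂ en₂ ,
       sumRel-complete (flipR r) n₁ p₂ (- c) en₁ ep₂ (holdsI-flip-sum⁻ r (+ suc x) (+ y) c h))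

    intRel-sound : ∀ v w → Encodes p₁ n₁ v → Encodes p₂ n₂ w →
      ⟦ ⋁ cases ⟧ₙ → holdsI r v (w + c)
    intRel-sound v w (ep₁ , en₁) (ep₂ , en₂) = ⋁-elim-stable cases (holdsI-stable r v (w + c)) sound
      where
      v⁺ : ⟦ isZero n₁ ⟧ₙ → v ≡ + encℤ⁺ v
      v⁺ z = encℤ⁻≡0⇒ v (isZero⁻ n₁ en₁ z)
      v⁻ : ⟦ isZero p₁ ⟧ₙ → v ≡ - (+ encℤ⁻ v)
      v⁻ z = encℤ⁺≡0⇒ v (isZero⁻ p₁ ep₁ z)
      w⁺ : ⟦ isZero n₂ ⟧ₙ → w ≡ + encℤ⁺ w
      w⁺ z = encℤ⁻≡0⇒ w (isZero⁻ n₂ en₂ z)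
      w⁻ : ⟦ isZero p₂ ⟧ₙ → w ≡ - (+ encℤ⁻ w)
      w⁻ z = encℤ⁺≡0⇒ w (isZero⁻ p₂ ep₂ z)
      holds : ∀ {v' w'} → v ≡ v' → w ≡ w' → holdsI r v' (w' + c) → holdsI r v (w + c)
      holds refl refl h = h
      sound : ∀ {φ} → φ ∈ cases → ⟦ φ ⟧ₙ → holdsI r v (w + c)
      sound (here refl) (z₁ , z₂ , (_ , _ , ep₁′ , ep₂′ , h))
        with refl ← just-injective (trans (sym ep₁) ep₁′) | refl ← just-injective (trans (sym ep₂) ep₂′) =
        holds (v⁺ z₁) (w⁺ z₂) h
      sound (there (here refl)) (z₁ , z₂ , (_ , _ , en₂′ , en₁′ , h))
        with refl ← just-injective (trans (sym en₂) en₂′) | refl ← just-injective (trans (sym en₁) en₁′) =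
        holds (v⁻ z₁) (w⁻ z₂) (holdsI-neg⁺ r (+ encℤ⁻ v) (+ encℤ⁻ w) c h)
      sound (there (there (here refl))) (z₁ , z₂ , h) =
        holds (v⁺ z₁) (w⁻ z₂) (holdsI-sum⁺ r (+ encℤ⁺ v) (+ encℤ⁻ w) c (sumRel-sound r p₁ n₂ c ep₁ en₂ h))
      sound (there (there (there (here refl)))) (z₁ , z₂ , h) =
        holds (v⁻ z₁) (w⁺ z₂)
          (holdsI-flip-sum⁺ r (+ encℤ⁻ v) (+ encℤ⁺ w) c (sumRel-sound (flipR r) n₁ p₂ (- c) en₁ ep₂ h))

  subsetF⁺ : ∀ X Y {A B} → valS X ≡ just A → valS Y ≡ just B → A ⊆L B → ⟦ subsetF X Y ⟧ₙ
  subsetF⁺ X Y eX eY A⊆B = _ , _ , eX , eY , A⊆B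

  subsetF⁻ : ∀ X Y {A B} → valS X ≡ just A → valS Y ≡ just B → ⟦ subsetF X Y ⟧ₙ → A ⊆L B
  subsetF⁻ X Y eX eY (_ , _ , eX′ , eY′ , h)
    with refl ← just-injective (trans (sym eX) eX′) | refl ← just-injective (trans (sym eY) eY′) = h

  setRel-defined : ∀ r P₁ N₁ P₂ N₂ → ⟦ setRel r P₁ N₁ P₂ N₂ ⟧ₙ →
    Defined (valS P₁) × Defined (valS N₁) × Defined (valS P₂) × Defined (valS N₂)
  setRel-defined eqS P₁ N₁ P₂ N₂ (((_ , _ , a , b , _) , (_ , _ , c , d , _)) , _) = (_ , a) , (_ , c) , (_ , b) , (_ , d)
  setRel-defined subS P₁ N₁ P₂ N₂ ((_ , _ , a , b , _) , (_ , _ , c , d , _)) = (_ , a) , (_ , c) , (_ , b) , (_ , d)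
  setRel-defined supS P₁ N₁ P₂ N₂ ((_ , _ , a , b , _) , (_ , _ , c , d , _)) = (_ , b) , (_ , d) , (_ , a) , (_ , c)
  setRel-defined ssubS P₁ N₁ P₂ N₂ (((_ , _ , a , b , _) , (_ , _ , c , d , _)) , _) = (_ , a) , (_ , c) , (_ , b) , (_ , d)
  setRel-defined ssupS P₁ N₁ P₂ N₂ (((_ , _ , a , b , _) , (_ , _ , c , d , _)) , _) = (_ , b) , (_ , d) , (_ , a) , (_ , c)

  module _ (P₁ N₁ P₂ N₂ : STerm K L M) {A B A⁺ A⁻ B⁺ B⁻}
           (eP₁ : valS P₁ ≡ just A⁺) (eN₁ : valS N₁ ≡ just A⁻)
           (eP₂ : valS P₂ ≡ just B⁺) (eN₂ : valS N₂ ≡ just B⁻)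
           (sA : SignSplit A A⁺ A⁻) (sB : SignSplit B B⁺ B⁻) where

    ⊆⇒subsetF₁₂ : A ⊆L B → ⟦ subsetF P₁ P₂ ∧ᶠ subsetF N₁ N₂ ⟧ₙ
    ⊆⇒subsetF₁₂ A⊆B =
      let P⊆ , N⊆ = split-⊆ sA sB A⊆B in subsetF⁺ P₁ P₂ eP₁ eP₂ P⊆ , subsetF⁺ N₁ N₂ eN₁ eN₂ N⊆

    ⊆⇒subsetF₂₁ : B ⊆L A → ⟦ subsetF P₂ P₁ ∧ᶠ subsetF N₂ N₁ ⟧ₙ
    ⊆⇒subsetF₂₁ B⊆A =
      let P⊆ , N⊆ = split-⊆ sB sA B⊆A in subsetF⁺ P₂ P₁ eP₂ eP₁ P⊆ , subsetF⁺ N₂ N₁ eN₂ eN₁ N⊆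

    subsetF₁₂⇒⊆ : ⟦ subsetF P₁ P₂ ∧ᶠ subsetF N₁ N₂ ⟧ₙ → A ⊆L B
    subsetF₁₂⇒⊆ (hP , hN) = split-⊆⁻ sA sB (subsetF⁻ P₁ P₂ eP₁ eP₂ hP) (subsetF⁻ N₁ N₂ eN₁ eN₂ hN)

    subsetF₂₁⇒⊆ : ⟦ subsetF P₂ P₁ ∧ᶠ subsetF N₂ N₁ ⟧ₙ → B ⊆L A
    subsetF₂₁⇒⊆ (hP , hN) = split-⊆⁻ sB sA (subsetF⁻ P₂ P₁ eP₂ eP₁ hP) (subsetF⁻ N₂ N₁ eN₂ eN₁ hN)

    setRel-complete : ∀ r → holdsS r A B → ⟦ setRel r P₁ N₁ P₂ N₂ ⟧ₙ
    setRel-complete eqS (A⊆B , B⊆A) = ⊆⇒subsetF₁₂ A⊆B , ⊆⇒subsetF₂₁ B⊆A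
    setRel-complete subS A⊆B = ⊆⇒subsetF₁₂ A⊆B
    setRel-complete supS B⊆A = ⊆⇒subsetF₂₁ B⊆A
    setRel-complete ssubS (A⊆B , B⊈A) = ⊆⇒subsetF₁₂ A⊆B , λ h → B⊈A (subsetF₂₁⇒⊆ h)
    setRel-complete ssupS (B⊆A , A⊈B) = ⊆⇒subsetF₂₁ B⊆A , λ h → A⊈B (subsetF₁₂⇒⊆ h)

    setRel-sound : ∀ r → ⟦ setRel r P₁ N₁ P₂ N₂ ⟧ₙ → holdsS r A B
    setRel-sound eqS (h₁₂ , h₂₁) = subsetF₁₂⇒⊆ h₁₂ , subsetF₂₁⇒⊆ h₂₁
    setRel-sound subS h₁₂ = subsetF₁₂⇒⊆ h₁₂
    setRel-sound supS h₂₁ = subsetF₂₁⇒⊆ h₂₁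
    setRel-sound ssubS (h₁₂ , ¬h₂₁) = subsetF₁₂⇒⊆ h₁₂ , λ B⊆A → ¬h₂₁ (⊆⇒subsetF₂₁ B⊆A)
    setRel-sound ssupS (h₂₁ , ¬h₁₂) = subsetF₂₁⇒⊆ h₂₁ , λ A⊆B → ¬h₁₂ (⊆⇒subsetF₁₂ A⊆B)

  validPair⁺ : ∀ x p n → Encodes p n x → ⟦ validPair p n ⟧ₙ
  validPair⁺ (+ _) p n (ep , en) = ⋁-intro {φs = isZero p ∷ isZero n ∷ []} (there (here refl)) (isZero⁺ n en)
  validPair⁺ -[1+ _ ] p n (ep , en) = ⋁-intro {φs = isZero p ∷ isZero n ∷ []} (here refl) (isZero⁺ p ep)

  validPair⁻ : ∀ x y p n → valI p ≡ just (+ x) → valI n ≡ just (+ y) → ⟦ validPair p n ⟧ₙ → x ≡ 0 ⊎ y ≡ 0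
  validPair⁻ zero y p n _ _ _ = inj₁ refl
  validPair⁻ (suc x) zero p n _ _ _ = inj₂ refl
  validPair⁻ (suc x) (suc y) p n ep en =
    ⋁-elim-stable (isZero p ∷ isZero n ∷ []) (λ ¬¬h → ⊥-elim (¬¬h [ (λ ()) , (λ ()) ]′))
      λ { (here refl) z → ⊥-elim (+suc≢0 (isZero⁻ p ep z)) ; (there (here refl)) z → ⊥-elim (+suc≢0 (isZero⁻ n en z)) }
    where
    +suc≢0 : ∀ {x} → + suc x ≢ + 0
    +suc≢0 ()

  zeroFree⁺ : ∀ N {A P A⁻} → SignSplit A P A⁻ → valS N ≡ just A⁻ → ⟦ zeroFree N ⟧ₙ
  zeroFree⁺ N sA e (_ , _ , refl , e′ , 0⊆) with refl ← just-injective (trans (sym e) e′) =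
    ℤP.<-irrefl refl (proj₂ (neg-sound sA (0⊆ (+ 0) (here refl))))

  zeroFree⁻ : ∀ N {Nv} → valS N ≡ just (L.map +_ Nv) → ⟦ zeroFree N ⟧ₙ → 0 ∉ Nv
  zeroFree⁻ N e h 0∈ = h (_ , _ , refl , e , λ { _ (here refl) → ∈-map⁺ +_ 0∈ })

  guardsF-weaken : ∀ (gs : List (Guard K L 0)) → ⟦ guardsF (L.map weakenG gs) ⟧ₙ ≡ ⟦ guardsF gs ⟧ Xs Gs []
  guardsF-weaken [] = refl
  guardsF-weaken (g ∷ gs) = cong₂ _×_ (guardF-weaken g) (guardsF-weaken gs)
    where
    guardF-weaken : ∀ g → ⟦ guardF (weakenG g) ⟧ₙ ≡ ⟦ guardF g ⟧ Xs Gs []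
    guardF-weaken (empty s) rewrite evalS-weakenS s Xs Gs Cs = refl
    guardF-weaken (nonempty s) rewrite evalS-weakenS s Xs Gs Cs = refl
    guardF-weaken (defined s) rewrite evalS-weakenS s Xs Gs Cs = refl

EncodesInts : ∀ {k} → Vec ℤ k → Vec ℤ (double k) → Set
EncodesInts {k} xs Xs =
  (i : Fin k) → lookup Xs (ix⁺ i) ≡ + encℤ⁺ (lookup xs i) × lookup Xs (ix⁻ i) ≡ + encℤ⁻ (lookup xs i)

EncodesSets : ∀ {l} → Vec (List ℤ) l → Vec (List ℤ) (double l) → Set
EncodesSets {l} Fs Gs = (i : Fin l) → SignSplit (lookup Fs i) (lookup Gs (ix⁺ i)) (lookup Gs (ix⁻ i))

record SetOp : Set₁ where
  field
    _⊙ₛ_ : ∀ {k l m} → STerm k l m → STerm k l m → STerm k l m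
    _⊙_ : List ℤ → List ℤ → List ℤ
    evalS-⊙ : ∀ {k l m} (s t : STerm k l m) xs Fs Bs →
      evalS (s ⊙ₛ t) xs Fs Bs ≡ map₂ _⊙_ (evalS s xs Fs Bs) (evalS t xs Fs Bs)
    split-⊙ : ∀ {A A⁺ A⁻ B B⁺ B⁻} → SignSplit A A⁺ A⁻ → SignSplit B B⁺ B⁻ →
      SignSplit (A ⊙ B) (A⁺ ⊙ B⁺) (A⁻ ⊙ B⁻)

∪-op ∩-op ∖-op : SetOp
∪-op = record { _⊙ₛ_ = _∪ₛ_ ; _⊙_ = _++_ ; evalS-⊙ = λ _ _ _ _ _ → refl ; split-⊙ = split-++ }
∩-op = record { _⊙ₛ_ = _∩ₛ_ ; _⊙_ = _∩L_ ; evalS-⊙ = λ _ _ _ _ _ → refl ; split-⊙ = split-∩L }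
∖-op = record { _⊙ₛ_ = _∖ₛ_ ; _⊙_ = _∖L_ ; evalS-⊙ = λ _ _ _ _ _ → refl ; split-⊙ = split-∖L }

module Terms {k l m} (xs : Vec ℤ k) (Fs : Vec (List ℤ) l) (Bs : Vec (List ℤ) m)
             (Xs : Vec ℤ (double k)) (Gs : Vec (List ℤ) (double l)) (Cs : Vec (List ℤ) (double m))
             (xs↦Xs : EncodesInts xs Xs) (Fs↦Gs : EncodesSets Fs Gs) (Bs↦Cs : EncodesSets Bs Cs) where
  open OverNat Xs Gs Cs
  open Derived ℕ +_
  open At Xs Gs Cs

  valSℤ : STerm k l m → Maybe (List ℤ)
  valSℤ s = evalS s xs Fs Bs

  valIℤ : ITerm k l m → Maybe ℤ
  valIℤ t = evalI t xs Fs Bs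

  SetCaseSound : STerm k l m → SetCase (double k) (double l) (double m) → Set
  SetCaseSound s (gs , P , N) = ⟦ guardsF gs ⟧ₙ → ∀ {A⁺ A⁻} → valS P ≡ just A⁺ → valS N ≡ just A⁻ →
    ∃ λ A → valSℤ s ≡ just A × SignSplit A A⁺ A⁻

  IntCaseSound : ITerm k l m → IntCase (double k) (double l) (double m) → Set
  IntCaseSound t (gs , p , n) = ⟦ guardsF gs ⟧ₙ → ∀ {a b} → valI p ≡ just a → valI n ≡ just b →
    ∃ λ v → valIℤ t ≡ just v × a ≡ + encℤ⁺ v × b ≡ + encℤ⁻ v

  SetCaseRepresents : SetCase (double k) (double l) (double m) → List ℤ → Set
  SetCaseRepresents (gs , P , N) A =
    ⟦ guardsF gs ⟧ₙ × ∃₂ λ A⁺ A⁻ → valS P ≡ just A⁺ × valS N ≡ just A⁻ × SignSplit A A⁺ A⁻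

  IntCaseRepresents : IntCase (double k) (double l) (double m) → ℤ → Set
  IntCaseRepresents (gs , p , n) v = ⟦ guardsF gs ⟧ₙ × Encodes p n v

  module _ (op : SetOp) where
    open SetOp op

    combineS-sound : ∀ s t c₁ c₂ → SetCaseSound s c₁ → SetCaseSound t c₂ →
      SetCaseSound (s ⊙ₛ t) (combineS _⊙ₛ_ c₁ c₂)
    combineS-sound s t (gs₁ , P₁ , N₁) (gs₂ , P₂ , N₂) sound₁ sound₂ hg eP eN
      with _ , _ , eP₁ , eP₂ , refl ← map₂≡just⁻ _⊙_ (valS P₁) (valS P₂) (trans (sym (evalS-⊙ P₁ P₂ Xs Gs Cs)) eP)
         | _ , _ , eN₁ , eN₂ , refl ← map₂≡just⁻ _⊙_ (valS N₁) (valS N₂) (trans (sym (evalS-⊙ N₁ N₂ Xs Gs Cs)) eN) =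
      let hg₁ , hg₂ = guardsF-++⁻ gs₁ gs₂ hg
          A , eA , sA = sound₁ hg₁ eP₁ eN₁
          B , eB , sB = sound₂ hg₂ eP₂ eN₂
      in A ⊙ B , trans (evalS-⊙ s t xs Fs Bs) (cong₂ (map₂ _⊙_) eA eB) , split-⊙ sA sB

    combineS-represents : ∀ c₁ c₂ {A B} → SetCaseRepresents c₁ A → SetCaseRepresents c₂ B →
      SetCaseRepresents (combineS _⊙ₛ_ c₁ c₂) (A ⊙ B)
    combineS-represents (gs₁ , P₁ , N₁) (gs₂ , P₂ , N₂) (hg₁ , _ , _ , eP₁ , eN₁ , sA) (hg₂ , _ , _ , eP₂ , eN₂ , sB) =
      guardsF-++⁺ gs₁ gs₂ hg₁ hg₂ , _ , _ ,
      trans (evalS-⊙ P₁ P₂ Xs Gs Cs) (cong₂ (map₂ _⊙_) eP₁ eP₂) ,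
      trans (evalS-⊙ N₁ N₂ Xs Gs Cs) (cong₂ (map₂ _⊙_) eN₁ eN₂) , split-⊙ sA sB

  singCase-represents : ∀ gs p n {v} → ⟦ guardsF gs ⟧ₙ → Encodes p n v →
    SetCaseRepresents (singCase (gs , p , n)) (v ∷ [])
  singCase-represents gs p n {v} hg (ep , en) rewrite ep | en = hg , _ , _ , refl , refl , split-singleton v

  splitS-sound : ∀ s {c} → c ∈ splitS s → SetCaseSound s c
  splitI-sound : ∀ t {c} → c ∈ splitI t → IntCaseSound t c

  splitS-sound ∅ (here refl) _ refl refl = [] , refl , split-[]
  splitS-sound (fvar i) (here refl) _ refl refl = _ , refl , Fs↦Gs i
  splitS-sound (bvar i) (here refl) _ refl refl = _ , refl , Bs↦Cs i
  splitS-sound (sing t) p hg eP eN with ∈-map⁻ singCase p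
  ... | (gs , p′ , n′) , q , refl with valI p′ in ep | valI n′ in en | eP | eN
  ... | just a | just b | refl | refl with splitI-sound t q hg ep en
  ... | v , ev , refl , refl = v ∷ [] , cong (mapM (_∷ [])) ev , split-singleton v
  splitS-sound (s ∪ₛ t) p with c₁ , c₂ , p₁ , p₂ , refl ← ∈-cartesianProductWith⁻ _ (splitS s) (splitS t) p =
    combineS-sound ∪-op s t c₁ c₂ (splitS-sound s p₁) (splitS-sound t p₂)
  splitS-sound (s ∩ₛ t) p with c₁ , c₂ , p₁ , p₂ , refl ← ∈-cartesianProductWith⁻ _ (splitS s) (splitS t) p =
    combineS-sound ∩-op s t c₁ c₂ (splitS-sound s p₁) (splitS-sound t p₂)
  splitS-sound (s ∖ₛ t) p with c₁ , c₂ , p₁ , p₂ , refl ← ∈-cartesianProductWith⁻ _ (splitS s) (splitS t) p =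
    combineS-sound ∖-op s t c₁ c₂ (splitS-sound s p₁) (splitS-sound t p₂)

  splitI-sound (icst c) (here refl) _ refl refl = c , refl , refl , refl
  splitI-sound (ivar i) (here refl) _ refl refl = lookup xs i , refl , xs↦Xs i
  splitI-sound (imin s) p h ea eb with ∈-map-++-map⁻ minCase⁺ minCase⁻ (splitS s) p
  ... | inj₁ ((gs , P , N) , q , refl) with refl ← eb | A⁺ , eP , min≡ ← bindM≡just⁻ (valS P) minL ea =
    let hgs , _ , _ , hN = extremumGuards⁻ gs P N (empty N) h
        A , eA , sA = splitS-sound s q hgs eP (empty⁻ N hN)
    in _ , trans (cong (λ X → bindM X minL) eA) (trans (minL-split-nonneg sA) min≡) ,
       encℤ-nonneg (proj₂ (pos-sound sA (proj₁ (minL-sound A⁺ min≡))))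
  ... | inj₂ ((gs , P , N) , q , refl) with refl ← ea | A⁻ , eN , max≡ ← bindM≡just⁻ (valS N) maxL eb =
    let hgs , (_ , eP) , _ = extremumGuards⁻ gs P N (nonempty N) h
        A , eA , sA = splitS-sound s q hgs eP eN
    in _ , trans (cong (λ X → bindM X minL) eA) (minL-split-neg sA max≡) ,
       encℤ-neg (proj₂ (neg-sound sA (proj₁ (maxL-sound A⁻ max≡))))
  splitI-sound (imax s) p h ea eb with ∈-map-++-map⁻ maxCase⁺ maxCase⁻ (splitS s) p
  ... | inj₁ ((gs , P , N) , q , refl) with refl ← eb | A⁺ , eP , max≡ ← bindM≡just⁻ (valS P) maxL ea =
    let hgs , _ , (_ , eN) , _ = extremumGuards⁻ gs P N (nonempty P) h
        A , eA , sA = splitS-sound s q hgs eP eN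
    in _ , trans (cong (λ X → bindM X maxL) eA) (maxL-split-nonneg sA max≡) ,
       encℤ-nonneg (proj₂ (pos-sound sA (proj₁ (maxL-sound A⁺ max≡))))
  ... | inj₂ ((gs , P , N) , q , refl) with refl ← ea | A⁻ , eN , min≡ ← bindM≡just⁻ (valS N) minL eb =
    let hgs , _ , _ , hP = extremumGuards⁻ gs P N (empty P) h
        A , eA , sA = splitS-sound s q hgs (empty⁻ P hP) eN
    in _ , trans (cong (λ X → bindM X maxL) eA) (maxL-split-neg sA min≡) ,
       encℤ-neg (proj₂ (neg-sound sA (proj₁ (minL-sound A⁻ min≡))))

  splitS-complete : ∀ s {A} → valSℤ s ≡ just A → ∃ λ c → c ∈ splitS s × SetCaseRepresents c A
  splitI-complete : ∀ t {v} → valIℤ t ≡ just v → ∃ λ c → c ∈ splitI t × IntCaseRepresents c v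

  splitS-complete ∅ refl = _ , here refl , ⊤ᶠ-intro , [] , [] , refl , refl , split-[]
  splitS-complete (fvar i) refl = _ , here refl , ⊤ᶠ-intro , _ , _ , refl , refl , Fs↦Gs i
  splitS-complete (bvar i) refl = _ , here refl , ⊤ᶠ-intro , _ , _ , refl , refl , Bs↦Cs i
  splitS-complete (sing t) e with v , ev , refl ← mapM≡just⁻ (_∷ []) (valIℤ t) e =
    let (gs , p , n) , c∈ , hg , enc = splitI-complete t ev in
    singCase (gs , p , n) , ∈-map⁺ singCase c∈ , singCase-represents gs p n hg enc
  splitS-complete (s ∪ₛ t) e with _ , _ , e₁ , e₂ , refl ← map₂≡just⁻ _ (valSℤ s) (valSℤ t) e =
    let c₁ , c₁∈ , r₁ = splitS-complete s e₁ ; c₂ , c₂∈ , r₂ = splitS-complete t e₂ in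
    _ , ∈-cartesianProductWith⁺ (combineS _∪ₛ_) c₁∈ c₂∈ , combineS-represents ∪-op c₁ c₂ r₁ r₂
  splitS-complete (s ∩ₛ t) e with _ , _ , e₁ , e₂ , refl ← map₂≡just⁻ _ (valSℤ s) (valSℤ t) e =
    let c₁ , c₁∈ , r₁ = splitS-complete s e₁ ; c₂ , c₂∈ , r₂ = splitS-complete t e₂ in
    _ , ∈-cartesianProductWith⁺ (combineS _∩ₛ_) c₁∈ c₂∈ , combineS-represents ∩-op c₁ c₂ r₁ r₂
  splitS-complete (s ∖ₛ t) e with _ , _ , e₁ , e₂ , refl ← map₂≡just⁻ _ (valSℤ s) (valSℤ t) e =
    let c₁ , c₁∈ , r₁ = splitS-complete s e₁ ; c₂ , c₂∈ , r₂ = splitS-complete t e₂ in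
    _ , ∈-cartesianProductWith⁺ (combineS _∖ₛ_) c₁∈ c₂∈ , combineS-represents ∖-op c₁ c₂ r₁ r₂

  splitI-complete (icst c) refl = _ , here refl , ⊤ᶠ-intro , refl , refl
  splitI-complete (ivar i) refl = _ , here refl , ⊤ᶠ-intro , cong just (proj₁ (xs↦Xs i)) , cong just (proj₂ (xs↦Xs i))
  splitI-complete (imin s) e with bindM≡just⁻ (valSℤ s) minL e
  ... | A , eA , min≡ with splitS-complete s eA
  ... | (gs , P , N) , c∈ , hgs , A⁺ , [] , eP , eN , sA =
    let v≡ , 0≡ = encℤ-nonneg (split-nonneg sA (proj₁ (minL-sound A min≡))) in
    minCase⁺ (gs , P , N) , ∈-++⁺ˡ (∈-map⁺ minCase⁺ c∈) ,
    extremumGuards⁺ gs P N (empty N) hgs eP eN (empty⁺ N eN) ,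
    trans (cong (λ X → bindM X minL) eP) (trans (sym (minL-split-nonneg sA)) (trans min≡ (cong just v≡))) ,
    cong just 0≡
  ... | (gs , P , N) , c∈ , hgs , A⁺ , x ∷ A⁻ , eP , eN , sA
    with b , max≡ ← maxL-∷ x A⁻
    with refl ← trans (sym min≡) (minL-split-neg sA max≡) =
    let 0<b = proj₂ (neg-sound sA (proj₁ (maxL-sound (x ∷ A⁻) max≡))) in
    minCase⁻ (gs , P , N) , ∈-++⁺ʳ (L.map minCase⁺ (splitS s)) (∈-map⁺ minCase⁻ c∈) ,
    extremumGuards⁺ gs P N (nonempty N) hgs eP eN (nonempty⁺ N eN) ,
    cong just (proj₁ (encℤ-neg 0<b)) ,
    trans (cong (λ X → bindM X maxL) eN) (trans max≡ (cong just (proj₂ (encℤ-neg 0<b))))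
  splitI-complete (imax s) e with bindM≡just⁻ (valSℤ s) maxL e
  ... | A , eA , max≡ with splitS-complete s eA
  ... | (gs , P , N) , c∈ , hgs , x ∷ A⁺ , A⁻ , eP , eN , sA
    with a , maxP≡ ← maxL-∷ x A⁺
    with refl ← trans (sym max≡) (maxL-split-nonneg sA maxP≡) =
    let v≡ , 0≡ = encℤ-nonneg (proj₂ (pos-sound sA (proj₁ (maxL-sound (x ∷ A⁺) maxP≡)))) in
    maxCase⁺ (gs , P , N) , ∈-++⁺ˡ (∈-map⁺ maxCase⁺ c∈) ,
    extremumGuards⁺ gs P N (nonempty P) hgs eP eN (nonempty⁺ P eP) ,
    trans (cong (λ X → bindM X maxL) eP) (trans maxP≡ (cong just v≡)) , cong just 0≡
  ... | (gs , P , N) , c∈ , hgs , [] , A⁻ , eP , eN , sA with minL A⁻ in min≡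
  ...   | nothing rewrite minL≡nothing⇒[] A⁻ min≡ | split-empty⁻ sA with () ← max≡
  ...   | just b with refl ← trans (sym max≡) (maxL-split-neg sA min≡) =
    let 0<b = proj₂ (neg-sound sA (proj₁ (minL-sound A⁻ min≡))) in
    maxCase⁻ (gs , P , N) , ∈-++⁺ʳ (L.map maxCase⁺ (splitS s)) (∈-map⁺ maxCase⁻ c∈) ,
    extremumGuards⁺ gs P N (empty P) hgs eP eN (empty⁺ P eP) ,
    cong just (proj₁ (encℤ-neg 0<b)) ,
    trans (cong (λ X → bindM X minL) eN) (trans min≡ (cong just (proj₂ (encℤ-neg 0<b))))

module ArithTerms {k l} (xs : Vec ℤ k) (Fs : Vec (List ℤ) l) (Xs : Vec ℤ (double k)) (Gs : Vec (List ℤ) (double l))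
                  (xs↦Xs : EncodesInts xs Xs) (Fs↦Gs : EncodesSets Fs Gs) where
  open OverNat Xs Gs []
  open Derived ℕ +_
  open At Xs Gs []
  open Terms xs Fs [] Xs Gs [] xs↦Xs Fs↦Gs (λ ())

  valM : MTerm (double k) (double l) → Maybe ℤ
  valM t = evalM t Xs Gs

  valMℤ : MTerm k l → Maybe ℤ
  valMℤ t = evalM t xs Fs

  ArithCaseSound : MTerm k l → ArithCase (double k) (double l) → Set
  ArithCaseSound t (gs , t′) = ⟦ guardsF gs ⟧ₙ → ∀ {v} → valM t′ ≡ just v → valMℤ t ≡ just v

  ArithCaseRepresents : ArithCase (double k) (double l) → ℤ → Set
  ArithCaseRepresents (gs , t′) v = ⟦ guardsF gs ⟧ₙ × valM t′ ≡ just v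

  module _ (_⊙ₘ_ : ∀ {k l} → MTerm k l → MTerm k l → MTerm k l) (_⊙_ : ℤ → ℤ → ℤ)
           (evalM-⊙ : ∀ {k l} (s t : MTerm k l) xs Fs →
             evalM (s ⊙ₘ t) xs Fs ≡ map₂ _⊙_ (evalM s xs Fs) (evalM t xs Fs)) where

    combineM-sound : ∀ s t c₁ c₂ → ArithCaseSound s c₁ → ArithCaseSound t c₂ →
      ArithCaseSound (s ⊙ₘ t) (combineM _⊙ₘ_ c₁ c₂)
    combineM-sound s t (gs₁ , a) (gs₂ , b) sound₁ sound₂ hg e
      with _ , _ , ea , eb , refl ← map₂≡just⁻ _⊙_ (valM a) (valM b) (trans (sym (evalM-⊙ a b Xs Gs)) e) =
      let hg₁ , hg₂ = guardsF-++⁻ gs₁ gs₂ hg in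
      trans (evalM-⊙ s t xs Fs) (cong₂ (map₂ _⊙_) (sound₁ hg₁ ea) (sound₂ hg₂ eb))

    combineM-represents : ∀ c₁ c₂ {v w} → ArithCaseRepresents c₁ v → ArithCaseRepresents c₂ w →
      ArithCaseRepresents (combineM _⊙ₘ_ c₁ c₂) (v ⊙ w)
    combineM-represents (gs₁ , a) (gs₂ , b) (hg₁ , ea) (hg₂ , eb) =
      guardsF-++⁺ gs₁ gs₂ hg₁ hg₂ , trans (evalM-⊙ a b Xs Gs) (cong₂ (map₂ _⊙_) ea eb)

  0-v≡-v : ∀ v → + 0 - v ≡ - v
  0-v≡-v v = ℤP.+-identityˡ (- v)

  splitM-sound : ∀ t {c} → c ∈ splitM t → ArithCaseSound t c
  splitM-sound (mcst c) (here refl) _ e = e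
  splitM-sound (mvar i) (here refl) _ e
    rewrite proj₁ (xs↦Xs i) | proj₂ (xs↦Xs i) = trans (cong just (sym (encℤ⁺-encℤ⁻ (lookup xs i)))) e
  splitM-sound (mmax s) p h e with ∈-map-++-map⁻ maxArith⁺ maxArith⁻ (splitS s) p
  ... | inj₁ ((gs , P , N) , q , refl) with A⁺ , eP , max≡ ← bindM≡just⁻ (valS P) maxL e =
    let hgs , _ , (_ , eN) , _ = extremumGuards⁻ gs P N (nonempty P) h
        A , eA , sA = splitS-sound s q hgs eP eN
    in trans (cong (λ X → bindM X maxL) eA) (maxL-split-nonneg sA max≡)
  ... | inj₂ ((gs , P , N) , q , refl)
    with _ , _ , refl , e′ , refl ← map₂≡just⁻ _-_ (just (+ 0)) (valM (mmin N)) e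
    with A⁻ , eN , min≡ ← bindM≡just⁻ (valS N) minL e′ =
    let hgs , _ , _ , hP = extremumGuards⁻ gs P N (empty P) h
        A , eA , sA = splitS-sound s q hgs (empty⁻ P hP) eN
    in trans (cong (λ X → bindM X maxL) eA) (trans (maxL-split-neg sA min≡) (cong just (sym (0-v≡-v _))))
  splitM-sound (mmin s) p h e with ∈-map-++-map⁻ minArith⁺ minArith⁻ (splitS s) p
  ... | inj₁ ((gs , P , N) , q , refl) with A⁺ , eP , min≡ ← bindM≡just⁻ (valS P) minL e =
    let hgs , _ , _ , hN = extremumGuards⁻ gs P N (empty N) h
        A , eA , sA = splitS-sound s q hgs eP (empty⁻ N hN)
    in trans (cong (λ X → bindM X minL) eA) (trans (minL-split-nonneg sA) min≡)
  ... | inj₂ ((gs , P , N) , q , refl)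
    with _ , _ , refl , e′ , refl ← map₂≡just⁻ _-_ (just (+ 0)) (valM (mmax N)) e
    with A⁻ , eN , max≡ ← bindM≡just⁻ (valS N) maxL e′ =
    let hgs , (_ , eP) , _ = extremumGuards⁻ gs P N (nonempty N) h
        A , eA , sA = splitS-sound s q hgs eP eN
    in trans (cong (λ X → bindM X minL) eA) (trans (minL-split-neg sA max≡) (cong just (sym (0-v≡-v _))))
  splitM-sound (s ⊕ t) p with c₁ , c₂ , p₁ , p₂ , refl ← ∈-cartesianProductWith⁻ _ (splitM s) (splitM t) p =
    combineM-sound _⊕_ _+_ (λ _ _ _ _ → refl) s t c₁ c₂ (splitM-sound s p₁) (splitM-sound t p₂)
  splitM-sound (s ⊖ t) p with c₁ , c₂ , p₁ , p₂ , refl ← ∈-cartesianProductWith⁻ _ (splitM s) (splitM t) p =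
    combineM-sound _⊖_ _-_ (λ _ _ _ _ → refl) s t c₁ c₂ (splitM-sound s p₁) (splitM-sound t p₂)

  splitM-complete : ∀ t {v} → valMℤ t ≡ just v → ∃ λ c → c ∈ splitM t × ArithCaseRepresents c v
  splitM-complete (mcst c) refl = _ , here refl , ⊤ᶠ-intro , refl
  splitM-complete (mvar i) refl = _ , here refl , ⊤ᶠ-intro ,
    cong just (trans (cong₂ _-_ (proj₁ (xs↦Xs i)) (proj₂ (xs↦Xs i))) (encℤ⁺-encℤ⁻ (lookup xs i)))
  splitM-complete (mmax s) e with bindM≡just⁻ (valSℤ s) maxL e
  ... | A , eA , max≡ with splitS-complete s eA
  ... | (gs , P , N) , c∈ , hgs , x ∷ A⁺ , A⁻ , eP , eN , sA
    with a , maxP≡ ← maxL-∷ x A⁺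
    with refl ← trans (sym max≡) (maxL-split-nonneg sA maxP≡) =
    maxArith⁺ (gs , P , N) , ∈-++⁺ˡ (∈-map⁺ maxArith⁺ c∈) ,
    extremumGuards⁺ gs P N (nonempty P) hgs eP eN (nonempty⁺ P eP) ,
    trans (cong (λ X → bindM X maxL) eP) maxP≡
  ... | (gs , P , N) , c∈ , hgs , [] , A⁻ , eP , eN , sA with minL A⁻ in min≡
  ...   | nothing rewrite minL≡nothing⇒[] A⁻ min≡ | split-empty⁻ sA with () ← max≡
  ...   | just b with refl ← trans (sym max≡) (maxL-split-neg sA min≡) =
    maxArith⁻ (gs , P , N) , ∈-++⁺ʳ (L.map maxArith⁺ (splitS s)) (∈-map⁺ maxArith⁻ c∈) ,
    extremumGuards⁺ gs P N (empty P) hgs eP eN (empty⁺ P eP) ,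
    trans (cong (map₂ _-_ (just (+ 0))) (trans (cong (λ X → bindM X minL) eN) min≡)) (cong just (0-v≡-v b))
  splitM-complete (mmin s) e with bindM≡just⁻ (valSℤ s) minL e
  ... | A , eA , min≡ with splitS-complete s eA
  ... | (gs , P , N) , c∈ , hgs , A⁺ , [] , eP , eN , sA =
    minArith⁺ (gs , P , N) , ∈-++⁺ˡ (∈-map⁺ minArith⁺ c∈) ,
    extremumGuards⁺ gs P N (empty N) hgs eP eN (empty⁺ N eN) ,
    trans (cong (λ X → bindM X minL) eP) (trans (sym (minL-split-nonneg sA)) min≡)
  ... | (gs , P , N) , c∈ , hgs , A⁺ , x ∷ A⁻ , eP , eN , sA
    with b , max≡ ← maxL-∷ x A⁻
    with refl ← trans (sym min≡) (minL-split-neg sA max≡) =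
    minArith⁻ (gs , P , N) , ∈-++⁺ʳ (L.map minArith⁺ (splitS s)) (∈-map⁺ minArith⁻ c∈) ,
    extremumGuards⁺ gs P N (nonempty N) hgs eP eN (nonempty⁺ N eN) ,
    trans (cong (map₂ _-_ (just (+ 0))) (trans (cong (λ X → bindM X maxL) eN) max≡)) (cong just (0-v≡-v b))
  splitM-complete (s ⊕ t) e with _ , _ , e₁ , e₂ , refl ← map₂≡just⁻ _+_ (valMℤ s) (valMℤ t) e =
    let c₁ , c₁∈ , r₁ = splitM-complete s e₁ ; c₂ , c₂∈ , r₂ = splitM-complete t e₂ in
    _ , ∈-cartesianProductWith⁺ (combineM _⊕_) c₁∈ c₂∈ , combineM-represents _⊕_ _+_ (λ _ _ _ _ → refl) c₁ c₂ r₁ r₂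
  splitM-complete (s ⊖ t) e with _ , _ , e₁ , e₂ , refl ← map₂≡just⁻ _-_ (valMℤ s) (valMℤ t) e =
    let c₁ , c₁∈ , r₁ = splitM-complete s e₁ ; c₂ , c₂∈ , r₂ = splitM-complete t e₂ in
    _ , ∈-cartesianProductWith⁺ (combineM _⊖_) c₁∈ c₂∈ , combineM-represents _⊖_ _-_ (λ _ _ _ _ → refl) c₁ c₂ r₁ r₂

open Sem ℤ id using () renaming (⟦_⟧ to ⟦_⟧ℤ)
open Sem ℕ +_ using () renaming (⟦_⟧ to ⟦_⟧ℕ)
open Derived ℤ id using () renaming (⟦⟧-stable to ⟦⟧ℤ-stable)

module Atoms {k l m} (xs : Vec ℤ k) (Fs : Vec (List ℤ) l) (Bs : Vec (List ℤ) m)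
             (Xs : Vec ℤ (double k)) (Gs : Vec (List ℤ) (double l)) (Cs : Vec (List ℤ) (double m))
             (xs↦Xs : EncodesInts xs Xs) (Fs↦Gs : EncodesSets Fs Gs) (Bs↦Cs : EncodesSets Bs Cs) where
  open OverNat Xs Gs Cs
  open Derived ℕ +_
  open At Xs Gs Cs
  open Terms xs Fs Bs Xs Gs Cs xs↦Xs Fs↦Gs Bs↦Cs
  open ArithTerms xs Fs Xs Gs xs↦Xs Fs↦Gs using (splitM-sound; splitM-complete)

  sAtom-complete : ∀ r s t → ⟦ sAtom r s t ⟧ℤ xs Fs Bs → ⟦ translate (sAtom r s t) ⟧ₙ
  sAtom-complete r s t (A , B , eA , eB , hr)
    with (gs₁ , P₁ , N₁) , c₁∈ , hg₁ , _ , _ , eP₁ , eN₁ , sA ← splitS-complete s eA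
       | (gs₂ , P₂ , N₂) , c₂∈ , hg₂ , _ , _ , eP₂ , eN₂ , sB ← splitS-complete t eB =
    ⋁-intro {φs = cartesianProductWith (sAtomCase r) (splitS s) (splitS t)}
      (∈-cartesianProductWith⁺ (sAtomCase r) c₁∈ c₂∈)
      (hg₁ , hg₂ , setRel-complete P₁ N₁ P₂ N₂ eP₁ eN₁ eP₂ eN₂ sA sB r hr)

  sAtom-sound : ∀ r s t → ⟦ translate (sAtom r s t) ⟧ₙ → ⟦ sAtom r s t ⟧ℤ xs Fs Bs
  sAtom-sound r s t = ⋁-elim-stable cases (⟦⟧ℤ-stable (sAtom r s t) xs Fs Bs) sound
    where
    cases : List (Formula (double k) (double l) (double m))
    cases = cartesianProductWith (sAtomCase r) (splitS s) (splitS t)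
    sound : ∀ {φ} → φ ∈ cases → ⟦ φ ⟧ₙ → ⟦ sAtom r s t ⟧ℤ xs Fs Bs
    sound p h
      with (gs₁ , P₁ , N₁) , (gs₂ , P₂ , N₂) , c₁∈ , c₂∈ , refl ← ∈-cartesianProductWith⁻ (sAtomCase r) (splitS s) (splitS t) p =
      let hg₁ , hg₂ , hr = h
          (_ , eP₁) , (_ , eN₁) , (_ , eP₂) , (_ , eN₂) = setRel-defined r P₁ N₁ P₂ N₂ hr
          A , eA , sA = splitS-sound s c₁∈ hg₁ eP₁ eN₁
          B , eB , sB = splitS-sound t c₂∈ hg₂ eP₂ eN₂
      in A , B , eA , eB , setRel-sound P₁ N₁ P₂ N₂ eP₁ eN₁ eP₂ eN₂ sA sB r hr

  iAtom-complete : ∀ r s t c → ⟦ iAtom r s t c ⟧ℤ xs Fs Bs → ⟦ translate (iAtom r s t c) ⟧ₙ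
  iAtom-complete r s t c (v , w , ev , ew , hr)
    with (gs₁ , p₁ , n₁) , c₁∈ , hg₁ , ep₁ , en₁ ← splitI-complete s ev
       | (gs₂ , p₂ , n₂) , c₂∈ , hg₂ , ep₂ , en₂ ← splitI-complete t ew =
    ⋁-intro {φs = cartesianProductWith (iAtomCase r c) (splitI s) (splitI t)}
      (∈-cartesianProductWith⁺ (iAtomCase r c) c₁∈ c₂∈)
      (hg₁ , hg₂ , (isDefined⁺ p₁ ep₁ , isDefined⁺ n₁ en₁ , isDefined⁺ p₂ ep₂ , isDefined⁺ n₂ en₂) ,
       intRel-complete r c p₁ n₁ p₂ n₂ v w (ep₁ , en₁) (ep₂ , en₂) hr)

  iAtom-sound : ∀ r s t c → ⟦ translate (iAtom r s t c) ⟧ₙ → ⟦ iAtom r s t c ⟧ℤ xs Fs Bs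
  iAtom-sound r s t c = ⋁-elim-stable cases (⟦⟧ℤ-stable (iAtom r s t c) xs Fs Bs) sound
    where
    cases : List (Formula (double k) (double l) (double m))
    cases = cartesianProductWith (iAtomCase r c) (splitI s) (splitI t)
    sound : ∀ {φ} → φ ∈ cases → ⟦ φ ⟧ₙ → ⟦ iAtom r s t c ⟧ℤ xs Fs Bs
    sound p h
      with (gs₁ , p₁ , n₁) , (gs₂ , p₂ , n₂) , c₁∈ , c₂∈ , refl ← ∈-cartesianProductWith⁻ (iAtomCase r c) (splitI s) (splitI t) p
      with hg₁ , hg₂ , ((_ , _ , ep₁ , _) , (_ , _ , en₁ , _) , (_ , _ , ep₂ , _) , (_ , _ , en₂ , _)) , hr ← h
      with v , ev , refl , refl ← splitI-sound s c₁∈ hg₁ ep₁ en₁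
         | w , ew , refl , refl ← splitI-sound t c₂∈ hg₂ ep₂ en₂ =
      v , w , ev , ew , intRel-sound r c p₁ n₁ p₂ n₂ v w (ep₁ , en₁) (ep₂ , en₂) hr

  mAtom-complete : ∀ r t → ⟦ mAtom {m = m} r t ⟧ℤ xs Fs Bs → ⟦ translate (mAtom {m = m} r t) ⟧ₙ
  mAtom-complete r t (v , ev , hr) with (gs , t′) , c∈ , hg , et ← splitM-complete t ev =
    ⋁-intro {φs = L.map (mAtomCase r) (splitM t)} (∈-map⁺ (mAtomCase r) c∈)
      (subst id (sym (guardsF-weaken gs)) hg , v , et , hr)

  mAtom-sound : ∀ r t → ⟦ translate (mAtom {m = m} r t) ⟧ₙ → ⟦ mAtom {m = m} r t ⟧ℤ xs Fs Bs
  mAtom-sound r t = ⋁-elim-stable (L.map (mAtomCase r) (splitM t)) (⟦⟧ℤ-stable (mAtom {m = m} r t) xs Fs Bs) sound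
    where
    sound : ∀ {φ} → φ ∈ L.map (mAtomCase r) (splitM t) → ⟦ φ ⟧ₙ → ⟦ mAtom {m = m} r t ⟧ℤ xs Fs Bs
    sound p h with (gs , t′) , c∈ , refl ← ∈-map⁻ (mAtomCase r) p =
      let hg , v , et , hr = h in
      v , splitM-sound t c∈ (subst id (guardsF-weaken gs) hg) et , hr

encodesInts-∷ : ∀ {k} {xs : Vec ℤ k} {Xs} x {p n} → EncodesInts xs Xs → encℤ⁺ x ≡ p → encℤ⁻ x ≡ n →
  EncodesInts (x ∷ xs) (+ p ∷ + n ∷ Xs)
encodesInts-∷ x xs↦Xs refl refl zero = refl , refl
encodesInts-∷ x xs↦Xs _ _ (suc i) = xs↦Xs i

encodesSets-∷ : ∀ {m} {Bs : Vec (List ℤ) m} {Cs A P N} → EncodesSets Bs Cs → SignSplit A P N →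
  EncodesSets (A ∷ Bs) (P ∷ N ∷ Cs)
encodesSets-∷ Bs↦Cs sA zero = sA
encodesSets-∷ Bs↦Cs sA (suc i) = Bs↦Cs i

split-map-id : ∀ {A P N} → SignSplit A P N → SignSplit (L.map id A) P N
split-map-id {A} {P} {N} = subst (λ X → SignSplit X P N) (sym (LP.map-id A))

translate-correct : ∀ {k l m} (φ : Formula k l m) xs Fs Bs Xs Gs Cs →
  EncodesInts xs Xs → EncodesSets Fs Gs → EncodesSets Bs Cs →
  ⟦ φ ⟧ℤ xs Fs Bs ⇔ ⟦ translate φ ⟧ℕ Xs Gs Cs
translate-correct (sAtom r s t) xs Fs Bs Xs Gs Cs xs↦Xs Fs↦Gs Bs↦Cs =
  mk⇔ (sAtom-complete r s t) (sAtom-sound r s t)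
  where open Atoms xs Fs Bs Xs Gs Cs xs↦Xs Fs↦Gs Bs↦Cs
translate-correct (iAtom r s t c) xs Fs Bs Xs Gs Cs xs↦Xs Fs↦Gs Bs↦Cs =
  mk⇔ (iAtom-complete r s t c) (iAtom-sound r s t c)
  where open Atoms xs Fs Bs Xs Gs Cs xs↦Xs Fs↦Gs Bs↦Cs
translate-correct (mAtom r t) xs Fs Bs Xs Gs Cs xs↦Xs Fs↦Gs Bs↦Cs =
  mk⇔ (mAtom-complete r t) (mAtom-sound r t)
  where open Atoms xs Fs Bs Xs Gs Cs xs↦Xs Fs↦Gs Bs↦Cs
translate-correct (φ ∧ᶠ ψ) xs Fs Bs Xs Gs Cs xs↦Xs Fs↦Gs Bs↦Cs =
  mk⇔ (λ (hφ , hψ) → to φ↔ hφ , to ψ↔ hψ) (λ (hφ , hψ) → from φ↔ hφ , from ψ↔ hψ)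
  where
  open Equivalence
  φ↔ : ⟦ φ ⟧ℤ xs Fs Bs ⇔ ⟦ translate φ ⟧ℕ Xs Gs Cs
  φ↔ = translate-correct φ xs Fs Bs Xs Gs Cs xs↦Xs Fs↦Gs Bs↦Cs
  ψ↔ : ⟦ ψ ⟧ℤ xs Fs Bs ⇔ ⟦ translate ψ ⟧ℕ Xs Gs Cs
  ψ↔ = translate-correct ψ xs Fs Bs Xs Gs Cs xs↦Xs Fs↦Gs Bs↦Cs
translate-correct (¬ᶠ φ) xs Fs Bs Xs Gs Cs xs↦Xs Fs↦Gs Bs↦Cs =
  mk⇔ (λ ¬hφ hφ′ → ¬hφ (from φ↔ hφ′)) (λ ¬hφ′ hφ → ¬hφ′ (to φ↔ hφ))
  where
  open Equivalence
  φ↔ : ⟦ φ ⟧ℤ xs Fs Bs ⇔ ⟦ translate φ ⟧ℕ Xs Gs Cs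
  φ↔ = translate-correct φ xs Fs Bs Xs Gs Cs xs↦Xs Fs↦Gs Bs↦Cs
translate-correct (∀ᵢ φ) xs Fs Bs Xs Gs Cs xs↦Xs Fs↦Gs Bs↦Cs = mk⇔ complete sound
  where
  open Equivalence
  φ↔ : ∀ x p n → encℤ⁺ x ≡ p → encℤ⁻ x ≡ n →
    ⟦ φ ⟧ℤ (x ∷ xs) Fs Bs ⇔ ⟦ translate φ ⟧ℕ (+ p ∷ + n ∷ Xs) Gs Cs
  φ↔ x p n e⁺ e⁻ = translate-correct φ (x ∷ xs) Fs Bs (+ p ∷ + n ∷ Xs) Gs Cs
    (encodesInts-∷ x xs↦Xs e⁺ e⁻) Fs↦Gs Bs↦Cs
  complete : ⟦ ∀ᵢ φ ⟧ℤ xs Fs Bs → ⟦ translate (∀ᵢ φ) ⟧ℕ Xs Gs Cs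
  complete h n p (valid , ¬hφ′) =
    let e⁺ , e⁻ = encℤ-joinInt p n
          (OverNat.validPair⁻ (+ p ∷ + n ∷ Xs) Gs Cs p n (ivar zero) (ivar (suc zero)) refl refl valid)
    in ¬hφ′ (to (φ↔ (joinInt p n) p n e⁺ e⁻) (h (joinInt p n)))
  sound : ⟦ translate (∀ᵢ φ) ⟧ℕ Xs Gs Cs → ⟦ ∀ᵢ φ ⟧ℤ xs Fs Bs
  sound h x = ⟦⟧ℤ-stable φ (x ∷ xs) Fs Bs λ ¬hφ →
    h (encℤ⁻ x) (encℤ⁺ x)
      (OverNat.validPair⁺ (+ encℤ⁺ x ∷ + encℤ⁻ x ∷ Xs) Gs Cs x (ivar zero) (ivar (suc zero)) (refl , refl) ,
       λ hφ′ → ¬hφ (from (φ↔ x _ _ refl refl) hφ′))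
translate-correct (∀ₛ φ) xs Fs Bs Xs Gs Cs xs↦Xs Fs↦Gs Bs↦Cs = mk⇔ complete sound
  where
  open Equivalence
  φ↔ : ∀ A P N → SignSplit A (L.map +_ P) (L.map +_ N) →
    ⟦ φ ⟧ℤ xs Fs (L.map id A ∷ Bs) ⇔ ⟦ translate φ ⟧ℕ Xs Gs (L.map +_ P ∷ L.map +_ N ∷ Cs)
  φ↔ A P N sA = translate-correct φ xs Fs (L.map id A ∷ Bs) Xs Gs (L.map +_ P ∷ L.map +_ N ∷ Cs)
    xs↦Xs Fs↦Gs (encodesSets-∷ Bs↦Cs (split-map-id sA))
  complete : ⟦ ∀ₛ φ ⟧ℤ xs Fs Bs → ⟦ translate (∀ₛ φ) ⟧ℕ Xs Gs Cs
  complete h N P (zero-free , ¬hφ′) =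
    let 0∉N = OverNat.zeroFree⁻ Xs Gs (L.map +_ P ∷ L.map +_ N ∷ Cs) (bvar (suc zero)) refl zero-free
    in ¬hφ′ (to (φ↔ (joinSigns P N) P N (split-joinSigns P N 0∉N)) (h (joinSigns P N)))
  sound : ⟦ translate (∀ₛ φ) ⟧ℕ Xs Gs Cs → ⟦ ∀ₛ φ ⟧ℤ xs Fs Bs
  sound h A = ⟦⟧ℤ-stable φ xs Fs (L.map id A ∷ Bs) λ ¬hφ →
    h (encSet⁻ A) (encSet⁺ A)
      (OverNat.zeroFree⁺ Xs Gs (L.map +_ (encSet⁺ A) ∷ L.map +_ (encSet⁻ A) ∷ Cs) (bvar (suc zero)) (split-encode A) refl ,
       λ hφ′ → ¬hφ (from (φ↔ A _ _ (split-encode A)) hφ′))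

validInt : ∀ {k l m} → Fin k → Formula (double k) l m
validInt i = validPair (ivar (ix⁺ i)) (ivar (ix⁻ i))

validSet : ∀ {k l m} → Fin l → Formula k (double l) m
validSet i = zeroFree (fvar (ix⁻ i))

translateFormula : ∀ {k l} → Formula k l 0 → Formula (double k) (double l) 0
translateFormula {k} {l} Φ = (⋀ (L.map validInt (allFin k)) ∧ᶠ ⋀ (L.map validSet (allFin l))) ∧ᶠ translate Φ

encodesInts-encInts : ∀ {k} (ns : Vec ℤ k) → EncodesInts (V.map id ns) (V.map +_ (encInts ns))
encodesInts-encInts (n ∷ ns) zero = refl , refl
encodesInts-encInts (n ∷ ns) (suc i) = encodesInts-encInts ns i

encodesSets-encSets : ∀ {l} (As : Vec (List ℤ) l) → EncodesSets (V.map (L.map id) As) (V.map (L.map (+_)) (encSets As))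
encodesSets-encSets (A ∷ As) zero = split-map-id (split-encode A)
encodesSets-encSets (A ∷ As) (suc i) = encodesSets-encSets As i

decodeInts : ∀ {k} → Vec ℕ (double k) → Vec ℤ k
decodeInts {zero} [] = []
decodeInts {suc k} (p ∷ n ∷ ms) = joinInt p n ∷ decodeInts ms

decodeSets : ∀ {l} → Vec (List ℕ) (double l) → Vec (List ℤ) l
decodeSets {zero} [] = []
decodeSets {suc l} (P ∷ N ∷ Bs) = joinSigns P N ∷ decodeSets Bs

encInts-decodeInts : ∀ {k} (ms : Vec ℕ (double k)) → (∀ i → lookup ms (ix⁺ i) ≡ 0 ⊎ lookup ms (ix⁻ i) ≡ 0) →
  ms ≡ encInts (decodeInts ms)
encInts-decodeInts {zero} [] _ = refl
encInts-decodeInts {suc k} (p ∷ n ∷ ms) valid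
  with e⁺ , e⁻ ← encℤ-joinInt p n (valid zero) rewrite e⁺ | e⁻ =
  cong (λ ms′ → p ∷ n ∷ ms′) (encInts-decodeInts ms (λ i → valid (suc i)))

encodesSets-decodeSets : ∀ {l} (Bs : Vec (List ℕ) (double l)) → (∀ i → 0 ∉ lookup Bs (ix⁻ i)) →
  EncodesSets (V.map (L.map id) (decodeSets Bs)) (V.map (L.map (+_)) Bs)
encodesSets-decodeSets {suc l} (P ∷ N ∷ Bs) valid zero = split-map-id (split-joinSigns P N (valid zero))
encodesSets-decodeSets {suc l} (P ∷ N ∷ Bs) valid (suc i) = encodesSets-decodeSets Bs (λ j → valid (suc j)) i

≋-encSets-decodeSets : ∀ {l} (Bs : Vec (List ℕ) (double l)) → (∀ i → 0 ∉ lookup Bs (ix⁻ i)) →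
  Bs ≋ encSets (decodeSets Bs)
≋-encSets-decodeSets {zero} [] _ = _
≋-encSets-decodeSets {suc l} (P ∷ N ∷ Bs) valid =
  let P∼ , N∼ = split⇒∼encSet (split-joinSigns P N (valid zero)) in
  P∼ , N∼ , ≋-encSets-decodeSets Bs (λ j → valid (suc j))

translateFormula-complete : ∀ {k l} (Φ : Formula k l 0) ns As →
  ℒℤ Φ ns As → ℒℕ (translateFormula Φ) (encInts ns) (encSets As)
translateFormula-complete {k} {l} Φ ns As h =
  (⋀-intro _ validInts , ⋀-intro _ validSets) ,
  Equivalence.to (translate-correct Φ _ _ [] Xs Gs [] (encodesInts-encInts ns) (encodesSets-encSets As) (λ ())) h
  where
  Xs : Vec ℤ (double k)
  Xs = V.map +_ (encInts ns)
  Gs : Vec (List ℤ) (double l)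
  Gs = V.map (L.map (+_)) (encSets As)
  open OverNat Xs Gs []
  open Derived ℕ +_ using (module At)
  open At Xs Gs []
  validInts : ∀ {φ} → φ ∈ L.map validInt (allFin k) → ⟦ φ ⟧ₙ
  validInts p with i , _ , refl ← ∈-map⁻ validInt p =
    let e⁺ , e⁻ = encodesInts-encInts ns i in
    validPair⁺ (lookup (V.map id ns) i) (ivar (ix⁺ i)) (ivar (ix⁻ i)) (cong just e⁺ , cong just e⁻)
  validSets : ∀ {φ} → φ ∈ L.map validSet (allFin l) → ⟦ φ ⟧ₙ
  validSets p with i , _ , refl ← ∈-map⁻ validSet p = zeroFree⁺ (fvar (ix⁻ i)) (encodesSets-encSets As i) refl

translateFormula-sound : ∀ {k l} (Φ : Formula k l 0) ms Bs → ℒℕ (translateFormula Φ) ms Bs →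
  ∃₂ λ ns As → ℒℤ Φ ns As × ms ≡ encInts ns × Bs ≋ encSets As
translateFormula-sound {k} {l} Φ ms Bs ((hInts , hSets) , h) =
  decodeInts ms , decodeSets Bs ,
  Equivalence.from (translate-correct Φ _ _ [] Xs Gs [] xs↦Xs (encodesSets-decodeSets Bs zeroFreeParts) (λ ())) h ,
  ms≡ , ≋-encSets-decodeSets Bs zeroFreeParts
  where
  Xs : Vec ℤ (double k)
  Xs = V.map +_ ms
  Gs : Vec (List ℤ) (double l)
  Gs = V.map (L.map (+_)) Bs
  open OverNat Xs Gs []
  open Derived ℕ +_ using (module At)
  open At Xs Gs []
  validPairs : ∀ i → lookup ms (ix⁺ i) ≡ 0 ⊎ lookup ms (ix⁻ i) ≡ 0
  validPairs i = validPair⁻ _ _ (ivar (ix⁺ i)) (ivar (ix⁻ i))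
    (cong just (VP.lookup-map (ix⁺ i) +_ ms)) (cong just (VP.lookup-map (ix⁻ i) +_ ms))
    (⋀-elim _ hInts (∈-map⁺ validInt (∈-allFin i)))
  zeroFreeParts : ∀ i → 0 ∉ lookup Bs (ix⁻ i)
  zeroFreeParts i = zeroFree⁻ (fvar (ix⁻ i)) (cong just (VP.lookup-map (ix⁻ i) (L.map (+_)) Bs))
    (⋀-elim _ hSets (∈-map⁺ validSet (∈-allFin i)))
  ms≡ : ms ≡ encInts (decodeInts ms)
  ms≡ = encInts-decodeInts ms validPairs
  xs↦Xs : EncodesInts (V.map id (decodeInts ms)) Xs
  xs↦Xs = subst (λ ms′ → EncodesInts (V.map id (decodeInts ms)) (V.map +_ ms′)) (sym ms≡)
    (encodesInts-encInts (decodeInts ms))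

-- The translation stays inside RQSPA⁻

module _ {k l m : ℕ} where

  minus-⊥ᶠ : Minus (⊥ᶠ {k} {l} {m})
  minus-⊥ᶠ = sAtom _ _ _

  minus-⋁ : ∀ (φs : List (Formula k l m)) → (∀ {φ} → φ ∈ φs → Minus φ) → Minus (⋁ φs)
  minus-⋁ [] _ = minus-⊥ᶠ
  minus-⋁ (φ ∷ φs) minus = ¬ᶠ ((¬ᶠ minus (here refl)) ∧ᶠ (¬ᶠ minus-⋁ φs (λ p → minus (there p))))

  minus-⋀ : ∀ (φs : List (Formula k l m)) → (∀ {φ} → φ ∈ φs → Minus φ) → Minus (⋀ φs)
  minus-⋀ [] _ = ¬ᶠ minus-⊥ᶠ
  minus-⋀ (φ ∷ φs) minus = minus (here refl) ∧ᶠ minus-⋀ φs (λ p → minus (there p))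

  minus-∈-map : ∀ {A : Set} {f : A → Formula k l m} → (∀ x → Minus (f x)) → ∀ {xs φ} → φ ∈ L.map f xs → Minus φ
  minus-∈-map {f = f} minus p with _ , _ , refl ← ∈-map⁻ f p = minus _

  minus-⋁-cartesianProductWith : ∀ {A B : Set} (f : A → B → Formula k l m) xs ys → (∀ x y → Minus (f x y)) →
    Minus (⋁ (cartesianProductWith f xs ys))
  minus-⋁-cartesianProductWith f xs ys minus = minus-⋁ _ λ p →
    let _ , _ , _ , _ , φ≡ = ∈-cartesianProductWith⁻ f xs ys p in subst Minus (sym φ≡) (minus _ _)

  minus-guardsF : ∀ gs → Minus (guardsF {k} {l} {m} gs)
  minus-guardsF gs = minus-⋀ _ (minus-∈-map guard)
    where
    guard : ∀ g → Minus (guardF g)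
    guard (empty s) = sAtom _ _ _
    guard (nonempty s) = sAtom _ _ _
    guard (defined s) = sAtom _ _ _

  minus-setRel : ∀ r (P₁ N₁ P₂ N₂ : STerm k l m) → Minus (setRel r P₁ N₁ P₂ N₂)
  minus-setRel eqS _ _ _ _ = (sAtom _ _ _ ∧ᶠ sAtom _ _ _) ∧ᶠ (sAtom _ _ _ ∧ᶠ sAtom _ _ _)
  minus-setRel subS _ _ _ _ = sAtom _ _ _ ∧ᶠ sAtom _ _ _
  minus-setRel supS _ _ _ _ = sAtom _ _ _ ∧ᶠ sAtom _ _ _
  minus-setRel ssubS _ _ _ _ = (sAtom _ _ _ ∧ᶠ sAtom _ _ _) ∧ᶠ (¬ᶠ (sAtom _ _ _ ∧ᶠ sAtom _ _ _))
  minus-setRel ssupS _ _ _ _ = (sAtom _ _ _ ∧ᶠ sAtom _ _ _) ∧ᶠ (¬ᶠ (sAtom _ _ _ ∧ᶠ sAtom _ _ _))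

  minus-sumLe : ∀ (a b : ITerm k l m) c → Minus (sumLe a b c)
  minus-sumLe a b (+ C) = minus-⋁ _ (minus-∈-map (λ _ → iAtom _ _ _ _ ∧ᶠ iAtom _ _ _ _))
  minus-sumLe a b -[1+ n ] = minus-⊥ᶠ

  minus-sumRel : ∀ r (a b : ITerm k l m) c → Minus (sumRel r a b c)
  minus-sumRel leR a b c = minus-sumLe a b c
  minus-sumRel geR a b c = iAtom _ _ _ _ ∧ᶠ (iAtom _ _ _ _ ∧ᶠ (¬ᶠ minus-sumLe a b (c - + 1)))
  minus-sumRel eqR a b c = minus-sumRel leR a b c ∧ᶠ minus-sumRel geR a b c

  minus-intRelCases : ∀ r c (p₁ n₁ p₂ n₂ : ITerm k l m) → Minus (⋁ (intRelCases r c p₁ n₁ p₂ n₂))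
  minus-intRelCases r c p₁ n₁ p₂ n₂ = minus-⋁ _ λ
    { (here refl) → iAtom _ _ _ _ ∧ᶠ (iAtom _ _ _ _ ∧ᶠ iAtom _ _ _ _)
    ; (there (here refl)) → iAtom _ _ _ _ ∧ᶠ (iAtom _ _ _ _ ∧ᶠ iAtom _ _ _ _)
    ; (there (there (here refl))) → iAtom _ _ _ _ ∧ᶠ (iAtom _ _ _ _ ∧ᶠ minus-sumRel r p₁ n₂ c)
    ; (there (there (there (here refl)))) → iAtom _ _ _ _ ∧ᶠ (iAtom _ _ _ _ ∧ᶠ minus-sumRel (flipR r) n₁ p₂ (- c))
    }

  minus-validPair : ∀ (p n : ITerm k l m) → Minus (validPair p n)
  minus-validPair p n = minus-⋁ _ λ { (here refl) → iAtom _ _ _ _ ; (there (here refl)) → iAtom _ _ _ _ }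

  minus-zeroFree : ∀ (N : STerm k l m) → Minus (zeroFree N)
  minus-zeroFree N = ¬ᶠ sAtom _ _ _

minus-translate : ∀ {k l m} {φ : Formula k l m} → Minus φ → Minus (translate φ)
minus-translate (sAtom r s t) = minus-⋁-cartesianProductWith _ (splitS s) (splitS t) λ (gs₁ , P₁ , N₁) (gs₂ , P₂ , N₂) →
  minus-guardsF gs₁ ∧ᶠ (minus-guardsF gs₂ ∧ᶠ minus-setRel r P₁ N₁ P₂ N₂)
minus-translate (iAtom r s t c) = minus-⋁-cartesianProductWith _ (splitI s) (splitI t) λ (gs₁ , p₁ , n₁) (gs₂ , p₂ , n₂) →
  minus-guardsF gs₁ ∧ᶠ (minus-guardsF gs₂ ∧ᶠ
    ((iAtom _ _ _ _ ∧ᶠ (iAtom _ _ _ _ ∧ᶠ (iAtom _ _ _ _ ∧ᶠ iAtom _ _ _ _))) ∧ᶠ minus-intRelCases r c p₁ n₁ p₂ n₂))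
minus-translate (φ ∧ᶠ ψ) = minus-translate φ ∧ᶠ minus-translate ψ
minus-translate (¬ᶠ φ) = ¬ᶠ minus-translate φ
minus-translate (∀ᵢ φ) = ∀ᵢ (∀ᵢ (¬ᶠ (minus-validPair _ _ ∧ᶠ (¬ᶠ minus-translate φ))))
minus-translate (∀ₛ φ) = ∀ₛ (∀ₛ (¬ᶠ (minus-zeroFree _ ∧ᶠ (¬ᶠ minus-translate φ))))

minus-translateFormula : ∀ {k l} {Φ : Formula k l 0} → Minus Φ → Minus (translateFormula Φ)
minus-translateFormula minusΦ =
  (minus-⋀ _ (minus-∈-map λ _ → minus-validPair _ _) ∧ᶠ minus-⋀ _ (minus-∈-map λ _ → minus-zeroFree _)) ∧ᶠ
  minus-translate minusΦ

lemma1 : ∀ {k l} (Φ : Formula k l 0) →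
    Σ (Formula (double k) (double l) 0) λ Φ' →
      ((ns : Vec ℤ k) (As : Vec (List ℤ) l) →
          ℒℤ Φ ns As → ℒℕ Φ' (encInts ns) (encSets As))
      × ((ms : Vec ℕ (double k)) (Bs : Vec (List ℕ) (double l)) →
          ℒℕ Φ' ms Bs →
          Σ (Vec ℤ k) λ ns → Σ (Vec (List ℤ) l) λ As →
            ℒℤ Φ ns As × ms ≡ encInts ns × Bs ≋ encSets As)
      × (Minus Φ → Minus Φ')
lemma1 Φ = translateFormula Φ , translateFormula-complete Φ , translateFormula-sound Φ , minus-translateFormula
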